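{- Let $L \xleftarrow{i_1} I \xrightarrow{i_2} R$ be a $!$-graph rewrite rule and let $m : L \rightarrow G$ be a $!$-graph matching. Then the rule has a rewrite at $m$: there exist $!$-graphs $D$ and $H$ and morphisms $d : I \rightarrow D$, $g : D \rightarrow G$, $r : R \rightarrow H$, $h : D \rightarrow H$ such that $g\circ d = m \circ i_1$, $h \circ d = r \circ i_2$, and both of these commuting squares are pushouts (in the category of $\mathcal{G}_{T!}$-typed graphs, and hence in $\mathbf{BGraph}_T$).
   Context: Fix a compressed monoidal signature $T=(O,M,\mathrm{dom},\mathrm{cod})$, $\mathrm{dom},\mathrm{cod}: M \rightarrow (O\times\{\mathsf{v},\mathsf{f}\})^*$. The derived compressed typegraph $\mathcal{G}_T$ has vertex set $O\sqcup M$, a self-loop on each $X\in O$, an edge $\mathrm{in}^a_{f,i}$ from $X$ to $f$ for each $f\in M$ and index $i$ with $\mathrm{dom}(f)[i]=(X,a)$, and an edge $\mathrm{out}^a_{f,j}$ from $f$ to $X$ for each index $j$ with $\mathrm{cod}(f)[j]=(X,a)$. $\mathcal{G}_{T!}$ is $\mathcal{G}_T$ plus a vertex $!$, a self-loop on $!$, and an edge from $!$ to each vertex of $\mathcal{G}_T$. For a finite directed multigraph $G$ typed over $\mathcal{G}_{T!}$, vertices typed in $O$, $M$, $!$ are wire-, node-, $!$-vertices; fixed-arity edges are those typed by an $\mathsf{f}$-tagged edge; $U$ deletes $!$-vertices and incident edges (and restricts morphisms). A string graph is a $\mathcal{G}_T$-typed graph whose typing restricts at each node-vertex to a bijection on incident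 fixed-arity edges and whose wire-vertices have at most one incoming and one outgoing edge; inputs (outputs) are wire-vertices with no incoming (outgoing) edge. An open subgraph $O'$ of a string graph $K$ is a string subgraph with no vertex adjacent to a wire-vertex outside $O'$ and no incident fixed-arity edge outside $O'$. $B(b)$ is the full subgraph on successors of a $!$-vertex $b$, $\beta(G)$ the full subgraph on $!$-vertices. A $!$-graph is a $\mathcal{G}_{T!}$-typed graph with $U(G)$ a string graph, $\beta(G)$ posetal (at most one edge between two vertices, edge relation a partial order), $U(B(b))$ open in $U(G)$ for each $!$-vertex $b$, and $B(b')\subseteq B(b)$ whenever $b'\in B(b)$; $\mathbf{BGraph}_T$ is the full subcategory of $\mathbf{Graph}/\mathcal{G}_{T!}$ on $!$-graphs. $\mathrm{In}_!(G)$ (resp. $\mathrm{Out}_!(G)$) is the full subgraph on the $!$-vertices and the inputs (resp. outputs) of $U(G)$; $\mathrm{Bound}_!(G)$ has vertices the $!$-vertices and the inputs and outputs of $U(G)$, and edges those from a $!$-vertex to one of these vertices. A $!$-graph rewrite rule is a span $L\xleftarrow{i_1} I \xrightarrow{i_2} R$ in $\mathbf{BGraph}_T$ such that $U(L),U(R)$ have no isolated wire-vertices and there are isomorphisms $\phi_I:\mathrm{In}_!(L)\cong\mathrm{In}_!(R)$, $\phi_O:\mathrm{Out}_!(L)\cong\mathrm{Out}_!(R)$, $\phi_L:\mathrm{Bound}_!(L)\cong I$, $\phi_R:\mathrm{Bound}_!(R)\cong I$ such that, with $j_1 = \phi_L\circ(\mathrm{In}_!(L)\hookrightarrow\mathrm{Bound}_!(L))$,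 $j_2 = \phi_R\circ(\mathrm{In}_!(R)\hookrightarrow \mathrm{Bound}_!(R))$ and $k_1,k_2$ defined likewise with $\mathrm{Out}_!$, the maps $i_1\circ j_1$, $i_2\circ j_2$, $i_1\circ k_1$, $i_2\circ k_2$ are the respective inclusions into $L$ and $R$, and $j_2\circ\phi_I=j_1$, $k_2\circ\phi_O=k_1$. A morphism $f: A\rightarrow B$ of $!$-graphs reflects $!$-box containment if every edge of $B$ from a $!$-vertex to a vertex in the image of $f$ lies in the image of $f$. A $!$-graph matching is a monomorphism $m : L \rightarrow G$ of $!$-graphs that reflects $!$-box containment and such that $U(m)$ is a local isomorphism: for every node-vertex $v$ of $U(L)$, $U(m)$ restricts to a bijection from the set of all edges incident to $v$ onto the set of all edges incident to $m(v)$. -}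

module Defs where

open import Data.Nat using (ℕ)
open import Data.Fin using (Fin)
open import Data.List using (List; length; lookup)
open import Data.Product using (Σ; _×_; _,_; proj₁; proj₂)
open import Data.Sum using (_⊎_; inj₁; inj₂)
open import Data.Empty using (⊥; ⊥-elim)
open import Data.Irrelevant using (Irrelevant; [_])
open import Data.Refinement using (Refinement; value; proof) renaming (_,_ to _∣_)
open import Relation.Nullary using (¬_)
open import Relation.Binary.PropositionalEquality using (_≡_; _≢_; refl; sym; trans; cong)
open import Function.Bundles using (_↔_)
open import Function.Base using (_∘_; id)

data Tag : Set where
  𝗏 𝖿 : Tag    -- 𝗏 = variable-arity tag, 𝖿 = fixed-arity tag

record Sig : Set₁ where
  field
    O   : Set
    M   : Set
    dom : M → List (O × Tag)
    cod : M → List (O × Tag)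

module Over (T : Sig) where
  open Sig T

  -- The typegraph  G_{T!}  (it contains G_T as the full subgraph on O ⊔ M)

  data TV : Set where
    ob   : O → TV
    mor  : M → TV
    bang : TV

  data TE : Set where
    loop     : O → TE
    inE      : (f : M) → Fin (length (dom f)) → TE
    outE     : (f : M) → Fin (length (cod f)) → TE
    bangLoop : TE
    bangOb   : O → TE
    bangMor  : M → TE

  tsrc : TE → TV
  tsrc (loop X)    = ob X
  tsrc (inE f i)   = ob (proj₁ (lookup (dom f) i))
  tsrc (outE f j)  = mor f
  tsrc bangLoop    = bang
  tsrc (bangOb X)  = bang
  tsrc (bangMor f) = bang

  ttgt : TE → TV
  ttgt (loop X)    = ob X
  ttgt (inE f i)   = mor f
  ttgt (outE f j)  = ob (proj₁ (lookup (cod f) j))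
  ttgt bangLoop    = bang
  ttgt (bangOb X)  = ob X
  ttgt (bangMor f) = mor f

  FixedT : TE → Set
  FixedT (inE f i)  = proj₂ (lookup (dom f) i) ≡ 𝖿
  FixedT (outE f j) = proj₂ (lookup (cod f) j) ≡ 𝖿
  FixedT _          = ⊥

  -- Directed multigraphs typed over G_{T!}  (objects of Graph/G_{T!})

  record TGraph : Set₁ where
    field
      V  : Set
      E  : Set
      s  : E → V
      t  : E → V
      τV : V → TV
      τE : E → TE
      τs : ∀ e → τV (s e) ≡ tsrc (τE e)
      τt : ∀ e → τV (t e) ≡ ttgt (τE e)
  open TGraph public

  record Hom (A B : TGraph) : Set where
    field
      fV  : V A → V B
      fE  : E A → E B
      fs  : ∀ e → fV (s A e) ≡ s B (fE e)
      ft  : ∀ e → fV (t A e) ≡ t B (fE e)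
      fτV : ∀ v → τV B (fV v) ≡ τV A v
      fτE : ∀ e → τE B (fE e) ≡ τE A e
  open Hom public

  idH : {A : TGraph} → Hom A A
  idH = record { fV = id ; fE = id ; fs = λ _ → refl ; ft = λ _ → refl
               ; fτV = λ _ → refl ; fτE = λ _ → refl }

  infixr 9 _∘H_
  _∘H_ : {A B C : TGraph} → Hom B C → Hom A B → Hom A C
  g ∘H f = record
    { fV  = fV g ∘ fV f
    ; fE  = fE g ∘ fE f
    ; fs  = λ e → trans (cong (fV g) (fs f e)) (fs g (fE f e))
    ; ft  = λ e → trans (cong (fV g) (ft f e)) (ft g (fE f e))
    ; fτV = λ v → trans (fτV g (fV f v)) (fτV f v)
    ; fτE = λ e → trans (fτE g (fE f e)) (fτE f e)
    }

  -- equality of morphisms (the components are functions)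
  infix 4 _≈H_
  _≈H_ : {A B : TGraph} → Hom A B → Hom A B → Set
  f ≈H g = (∀ v → fV f v ≡ fV g v) × (∀ e → fE f e ≡ fE g e)

  IsIso : {A B : TGraph} → Hom A B → Set
  IsIso {A} {B} f = Σ (Hom B A) λ g → (g ∘H f ≈H idH) × (f ∘H g ≈H idH)

  -- pushout square in Graph/G_{T!}:   A --f--> B
  --                                   |g       |p
  --                                   C --q--> P
  IsPushout : {A B C P : TGraph} → Hom A B → Hom A C → Hom B P → Hom C P → Set₁
  IsPushout {A} {B} {C} {P} f g p q =
    (p ∘H f ≈H q ∘H g) ×
    (∀ (Q : TGraph) (x : Hom B Q) (y : Hom C Q) → x ∘H f ≈H y ∘H g →
       Σ (Hom P Q) λ u → ((u ∘H p ≈H x) × (u ∘H q ≈H y)) ×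
         (∀ (u' : Hom P Q) → u' ∘H p ≈H x → u' ∘H q ≈H y → u' ≈H u))

  IsFinite : TGraph → Set
  IsFinite G = (Σ ℕ λ n → V G ↔ Fin n) × (Σ ℕ λ k → E G ↔ Fin k)

  -- Subgraphs (given by predicates; membership is proof-irrelevant)

  subG : (G : TGraph) (PV : V G → Set) (PE : E G → Set) →
         (∀ e → PE e → PV (s G e) × PV (t G e)) → TGraph
  subG G PV PE cl = record
    { V  = Refinement (V G) PV
    ; E  = Refinement (E G) PE
    ; s  = λ { (e ∣ [ p ]) → s G e ∣ [ proj₁ (cl e p) ] }
    ; t  = λ { (e ∣ [ p ]) → t G e ∣ [ proj₂ (cl e p) ] }
    ; τV = λ v → τV G (value v)
    ; τE = λ e → τE G (value e)
    ; τs = λ e → τs G (value e)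
    ; τt = λ e → τt G (value e)
    }

  fullG : (G : TGraph) (PV : V G → Set) → TGraph
  fullG G PV = subG G PV (λ e → PV (s G e) × PV (t G e)) (λ e p → p)

  subIncl : (G : TGraph) (PV : V G → Set) (PE : E G → Set) →
            (cl : ∀ e → PE e → PV (s G e) × PV (t G e)) → Hom (subG G PV PE cl) G
  subIncl G PV PE cl = record
    { fV = value ; fE = value
    ; fs = λ { (e ∣ [ p ]) → refl } ; ft = λ { (e ∣ [ p ]) → refl }
    ; fτV = λ _ → refl ; fτE = λ _ → refl }

  fullIncl : (G : TGraph) (PV : V G → Set) → Hom (fullG G PV) G
  fullIncl G PV = subIncl G PV (λ e → PV (s G e) × PV (t G e)) (λ e p → p)

  module _ (G : TGraph) where
    IsWire : V G → Set
    IsWire v = Σ O λ X → τV G v ≡ ob X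

    IsNode : V G → Set
    IsNode v = Σ M λ f → τV G v ≡ mor f

    IsBang : V G → Set
    IsBang v = τV G v ≡ bang

    NonBang : V G → Set
    NonBang v = τV G v ≢ bang

    Fixed : E G → Set
    Fixed e = FixedT (τE G e)

    Incident : V G → E G → Set
    Incident v e = (s G e ≡ v) ⊎ (t G e ≡ v)

    Adjacent : V G → V G → Set
    Adjacent v w = Σ (E G) λ e → ((s G e ≡ v) × (t G e ≡ w)) ⊎ ((s G e ≡ w) × (t G e ≡ v))

    EdgeBetween : V G → V G → Set
    EdgeBetween x y = Σ (E G) λ e → (s G e ≡ x) × (t G e ≡ y)

  U : TGraph → TGraph
  U G = fullG G (NonBang G)

  UIncident : (G : TGraph) → V G → E G → Set
  UIncident G v e = (NonBang G (s G e) × NonBang G (t G e)) × Incident G v e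

  -- typing restricts at v to a bijection between the fixed-arity edges of K
  -- incident to v and the fixed-arity edges of the typegraph incident to τ(v)
  NodeBij : (K : TGraph) → V K → Set
  NodeBij K v =
    (∀ e e' → Incident K v e → Fixed K e → Incident K v e' → Fixed K e' →
       τE K e ≡ τE K e' → e ≡ e') ×
    (∀ (te : TE) → ((tsrc te ≡ τV K v) ⊎ (ttgt te ≡ τV K v)) → FixedT te →
       Σ (E K) λ e → (Incident K v e × Fixed K e) × (τE K e ≡ te))

  record IsStringGraph (K : TGraph) : Set where
    field
      typedOverGT : ∀ v → NonBang K v          -- i.e. K is G_T-typed
      nodeBij     : ∀ v → IsNode K v → NodeBij K v
      wireIn      : ∀ v → IsWire K v → ∀ e e' → t K e ≡ v → t K e' ≡ v → e ≡ e'
      wireOut     : ∀ v → IsWire K v → ∀ e e' → s K e ≡ v → s K e' ≡ v → e ≡ e'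

  record IsOpenFull (K : TGraph) (PV : V K → Set) : Set where
    field
      stringSub  : IsStringGraph (fullG K PV)
      noWireAdj  : ∀ v w → PV v → ¬ PV w → IsWire K w → ¬ Adjacent K v w
      fixedInside : ∀ v e → PV v → Incident K v e → Fixed K e →
                    PV (s K e) × PV (t K e)

  -- B(b) as a vertex predicate: successors of b
  InBox : (G : TGraph) → V G → V G → Set
  InBox G b v = EdgeBetween G b v

  record IsBangGraph (G : TGraph) : Set where
    field
      finite      : IsFinite G
      stringU     : IsStringGraph (U G)
      -- β(G) is posetal
      βsimple     : ∀ e e' → IsBang G (s G e) → IsBang G (t G e) →
                    s G e ≡ s G e' → t G e ≡ t G e' → e ≡ e'
      βrefl       : ∀ b → IsBang G b → EdgeBetween G b b
      βtrans      : ∀ a b c → IsBang G a → IsBang G b → IsBang G c →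
                    EdgeBetween G a b → EdgeBetween G b c → EdgeBetween G a c
      βantisym    : ∀ a b → IsBang G a → IsBang G b →
                    EdgeBetween G a b → EdgeBetween G b a → a ≡ b
      boxOpen     : ∀ b → IsBang G b → IsOpenFull (U G) (λ x → InBox G b (value x))
      boxNest     : ∀ b b' → IsBang G b → IsBang G b' → InBox G b b' →
                    ∀ v → InBox G b' v → InBox G b v

  -- inputs / outputs of U(G) (incoming/outgoing edges counted in U(G))
  IsInput : (G : TGraph) → V G → Set
  IsInput G v = IsWire G v ×
    (∀ e → NonBang G (s G e) → NonBang G (t G e) → t G e ≢ v)

  IsOutput : (G : TGraph) → V G → Set
  IsOutput G v = IsWire G v ×
    (∀ e → NonBang G (s G e) → NonBang G (t G e) → s G e ≢ v)

  InV OutV BoundV : (G : TGraph) → V G → Set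
  InV G v    = IsBang G v ⊎ IsInput G v
  OutV G v   = IsBang G v ⊎ IsOutput G v
  BoundV G v = IsBang G v ⊎ (IsInput G v ⊎ IsOutput G v)

  In! Out! Bound! : TGraph → TGraph
  In! G    = fullG G (InV G)
  Out! G   = fullG G (OutV G)
  Bound! G = subG G (BoundV G) (λ e → IsBang G (s G e) × BoundV G (t G e))
                    (λ e p → inj₁ (proj₁ p) , proj₂ p)

  inclInL : (G : TGraph) → Hom (In! G) G
  inclInL G = fullIncl G (InV G)

  inclOutL : (G : TGraph) → Hom (Out! G) G
  inclOutL G = fullIncl G (OutV G)

  private
    tgtBang : ∀ te → ttgt te ≡ bang → tsrc te ≡ bang
    tgtBang (loop X) ()
    tgtBang (inE f i) ()
    tgtBang (outE f j) ()
    tgtBang bangLoop p = refl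
    tgtBang (bangOb X) ()
    tgtBang (bangMor f) ()

    wireNB : (G : TGraph) (v : V G) → IsWire G v → NonBang G v
    wireNB G v (X , p) q with trans (sym p) q
    ... | ()

    bangT⇒bangS : (G : TGraph) (e : E G) → IsBang G (t G e) → IsBang G (s G e)
    bangT⇒bangS G e b = trans (τs G e) (tgtBang (τE G e) (trans (sym (τt G e)) b))

  inEdgeBang : (G : TGraph) (e : E G) → InV G (s G e) × InV G (t G e) → IsBang G (s G e)
  inEdgeBang G e (inj₁ b , _) = b
  inEdgeBang G e (inj₂ (w , _) , inj₁ b) = ⊥-elim (wireNB G (s G e) w (bangT⇒bangS G e b))
  inEdgeBang G e (inj₂ (w , _) , inj₂ (w' , noIn)) =
    ⊥-elim (noIn e (wireNB G (s G e) w) (wireNB G (t G e) w') refl)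

  outEdgeBang : (G : TGraph) (e : E G) → OutV G (s G e) × OutV G (t G e) → IsBang G (s G e)
  outEdgeBang G e (inj₁ b , _) = b
  outEdgeBang G e (inj₂ (w , noOut) , q) =
    ⊥-elim (noOut e (wireNB G (s G e) w) (tNB q) refl)
    where
      tNB : OutV G (t G e) → NonBang G (t G e)
      tNB (inj₁ b) = ⊥-elim (wireNB G (s G e) w (bangT⇒bangS G e b))
      tNB (inj₂ (w' , _)) = wireNB G (t G e) w'

  private
    inToBound : (G : TGraph) (v : V G) → InV G v → BoundV G v
    inToBound G v (inj₁ b) = inj₁ b
    inToBound G v (inj₂ i) = inj₂ (inj₁ i)

    outToBound : (G : TGraph) (v : V G) → OutV G v → BoundV G v
    outToBound G v (inj₁ b) = inj₁ b
    outToBound G v (inj₂ o) = inj₂ (inj₂ o)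

  inclInB : (G : TGraph) → Hom (In! G) (Bound! G)
  inclInB G = record
    { fV  = λ { (v ∣ [ p ]) → v ∣ [ inToBound G v p ] }
    ; fE  = λ { (e ∣ [ p ]) → e ∣ [ inEdgeBang G e p , inToBound G (t G e) (proj₂ p) ] }
    ; fs  = λ { (e ∣ [ p ]) → refl }
    ; ft  = λ { (e ∣ [ p ]) → refl }
    ; fτV = λ _ → refl
    ; fτE = λ _ → refl
    }

  inclOutB : (G : TGraph) → Hom (Out! G) (Bound! G)
  inclOutB G = record
    { fV  = λ { (v ∣ [ p ]) → v ∣ [ outToBound G v p ] }
    ; fE  = λ { (e ∣ [ p ]) → e ∣ [ outEdgeBang G e p , outToBound G (t G e) (proj₂ p) ] }
    ; fs  = λ { (e ∣ [ p ]) → refl }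
    ; ft  = λ { (e ∣ [ p ]) → refl }
    ; fτV = λ _ → refl
    ; fτE = λ _ → refl
    }

  NoIsolatedWires : TGraph → Set
  NoIsolatedWires G = ∀ v → IsWire G v → Σ (E G) λ e → UIncident G v e

  record IsRewriteRule {L I R : TGraph} (i₁ : Hom I L) (i₂ : Hom I R) : Set where
    field
      bgL   : IsBangGraph L
      bgI   : IsBangGraph I
      bgR   : IsBangGraph R
      noIsoL : NoIsolatedWires L
      noIsoR : NoIsolatedWires R
      φI    : Hom (In! L) (In! R)
      φO    : Hom (Out! L) (Out! R)
      φL    : Hom (Bound! L) I
      φR    : Hom (Bound! R) I
      φI-iso : IsIso φI
      φO-iso : IsIso φO
      φL-iso : IsIso φL
      φR-iso : IsIso φR
    j₁ = φL ∘H inclInB L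
    j₂ = φR ∘H inclInB R
    k₁ = φL ∘H inclOutB L
    k₂ = φR ∘H inclOutB R
    field
      i₁j₁ : i₁ ∘H j₁ ≈H inclInL L
      i₂j₂ : i₂ ∘H j₂ ≈H inclInL R
      i₁k₁ : i₁ ∘H k₁ ≈H inclOutL L
      i₂k₂ : i₂ ∘H k₂ ≈H inclOutL R
      j₂φI : j₂ ∘H φI ≈H j₁
      k₂φO : k₂ ∘H φO ≈H k₁

  ReflectsBoxContainment : {A B : TGraph} → Hom A B → Set
  ReflectsBoxContainment {A} {B} f =
    ∀ (e' : E B) (v : V A) → IsBang B (s B e') → t B e' ≡ fV f v →
      Σ (E A) λ e → fE f e ≡ e'

  IsLocalIsoU : {A B : TGraph} → Hom A B → Set
  IsLocalIsoU {A} {B} f =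
    ∀ v → IsNode A v →
      (∀ e e' → UIncident A v e → UIncident A v e' → fE f e ≡ fE f e' → e ≡ e') ×
      (∀ e' → UIncident B (fV f v) e' → Σ (E A) λ e → UIncident A v e × (fE f e ≡ e'))

  IsMono : {A B : TGraph} → Hom A B → Set
  IsMono f = (∀ x y → fV f x ≡ fV f y → x ≡ y) × (∀ x y → fE f x ≡ fE f y → x ≡ y)

  record IsMatching {L G : TGraph} (m : Hom L G) : Set where
    field
      bgL     : IsBangGraph L
      bgG     : IsBangGraph G
      mono    : IsMono m
      reflBox : ReflectsBoxContainment m
      locIso  : IsLocalIsoU m

module Submission where

-- Both pushout squares are constructed explicitly.  D is G with the image of
-- L ∖ i₁(I) deleted; it is a subgraph because of the dangling condition (every
-- edge of G at a deleted vertex comes from L), which follows from reflection of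
-- !-box containment, local isomorphism at node-vertices, and the fact that the
-- wire-vertices of L outside the interface are neither inputs nor outputs.  H is
-- D glued with R ∖ i₂(I).

open import Defs
open import Level using (Level)
open import Data.Nat using (ℕ; zero; suc)
open import Data.Fin using (Fin; zero; suc)
open import Data.Fin.Properties using (+↔⊎; any?; all?)
open import Data.Product using (Σ; _×_; _,_; proj₁; proj₂; ∃) renaming (map to map-×)
open import Data.Sum using (_⊎_; inj₁; inj₂) renaming ([_,_] to either)
open import Data.Sum.Properties using (inj₁-injective; inj₂-injective)
open import Data.Sum.Function.Propositional using (_⊎-↔_)
open import Data.Unit using (⊤; tt)
open import Data.Empty using (⊥; ⊥-elim; ⊥-elim-irr)
open import Data.Irrelevant using ([_])
open import Data.Refinement using (Refinement; value; value-injective) renaming (_,_ to _∣_)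
open import Relation.Nullary using (¬_; Dec; yes; no)
open import Relation.Nullary.Decidable using (map′; recompute; ¬?; _×-dec_; _⊎-dec_; _→-dec_)
open import Relation.Nullary.Negation using (contradiction; contradiction-irr)
open import Relation.Unary using (Decidable)
open import Relation.Binary.Definitions using (DecidableEquality)
open import Relation.Binary.PropositionalEquality using (_≡_; _≢_; refl; sym; trans; cong; subst; module ≡-Reasoning)
open import Function.Base using (_∘_)
open import Function.Bundles using (_↔_; Inverse; mk↔ₛ′)
open import Function.Properties.Inverse using (↔-trans; ↔-sym)

private variable
  a p : Level
  A B : Set a

Finite : Set a → Set a
Finite A = Σ ℕ λ n → A ↔ Fin n

module _ (fin : Finite A) where
  open Inverse (proj₂ fin)

  finite-≟ : DecidableEquality A
  finite-≟ x y = map′ (λ eq → trans (sym (strictlyInverseʳ x)) (trans (cong from eq) (strictlyInverseʳ y)))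
                      (cong to) (to x Data.Fin.≟ to y)

  finite-∃? : {P : A → Set p} → Decidable P → Dec (∃ P)
  finite-∃? {P = P} P? = map′ (λ (i , pi) → from i , pi)
                              (λ (x , px) → to x , subst P (sym (strictlyInverseʳ x)) px)
                              (any? (P? ∘ from))

  finite-∀? : {P : A → Set p} → Decidable P → Dec (∀ x → P x)
  finite-∀? {P = P} P? = map′ (λ h x → subst P (strictlyInverseʳ x) (h (to x))) (λ h i → h (from i))
                              (all? (P? ∘ from))

finite-↔ : A ↔ B → Finite B → Finite A
finite-↔ A↔B (n , B↔Fin) = n , ↔-trans A↔B B↔Fin

finite-⊎ : Finite A → Finite B → Finite (A ⊎ B)
finite-⊎ (n , A↔) (k , B↔) = _ , ↔-trans (A↔ ⊎-↔ B↔) (↔-sym +↔⊎)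

finite-dec : {P : ⊤ → Set p} → Dec (P tt) → Finite (Refinement ⊤ P)
finite-dec (yes p) = 1 , mk↔ₛ′ (λ _ → zero) (λ _ → tt ∣ [ p ]) (λ { zero → refl }) (λ { (tt ∣ [ _ ]) → refl })
finite-dec (no ¬p) = 0 , mk↔ₛ′ (λ { (tt ∣ [ p ]) → contradiction-irr p ¬p }) (λ ()) (λ ())
                                (λ { (tt ∣ [ p ]) → contradiction-irr p ¬p })

refine-Fin-suc : {n : ℕ} {P : Fin (suc n) → Set p} →
                 Refinement (Fin (suc n)) P ↔ (Refinement ⊤ (λ _ → P zero) ⊎ Refinement (Fin n) (P ∘ suc))
refine-Fin-suc {n = n} {P = P} = mk↔ₛ′ split join
  (λ { (inj₁ (tt ∣ [ _ ])) → refl ; (inj₂ (_ ∣ [ _ ])) → refl })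
  (λ { (zero ∣ [ _ ]) → refl ; (suc _ ∣ [ _ ]) → refl })
  where
    split : Refinement (Fin (suc n)) P → Refinement ⊤ (λ _ → P zero) ⊎ Refinement (Fin n) (P ∘ suc)
    split (zero ∣ [ p ]) = inj₁ (tt ∣ [ p ])
    split (suc i ∣ [ p ]) = inj₂ (i ∣ [ p ])
    join : Refinement ⊤ (λ _ → P zero) ⊎ Refinement (Fin n) (P ∘ suc) → Refinement (Fin (suc n)) P
    join (inj₁ (tt ∣ [ p ])) = zero ∣ [ p ]
    join (inj₂ (i ∣ [ p ])) = suc i ∣ [ p ]

refine-Fin : (n : ℕ) {P : Fin n → Set p} → Decidable P → Finite (Refinement (Fin n) P)
refine-Fin zero    P? = 0 , mk↔ₛ′ (λ { (() ∣ _) }) (λ ()) (λ ()) (λ { (() ∣ _) })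
refine-Fin (suc n) P? =
  finite-↔ refine-Fin-suc (finite-⊎ (finite-dec (P? zero)) (refine-Fin n (P? ∘ suc)))

finite-refine : {P : A → Set p} → Finite A → Decidable P → Finite (Refinement A P)
finite-refine {A = A} {P = P} (n , A↔Fin) P? =
  finite-↔ transport (refine-Fin n (P? ∘ from))
  where
    open Inverse A↔Fin
    transport : Refinement A P ↔ Refinement (Fin n) (P ∘ from)
    transport = mk↔ₛ′ (λ { (x ∣ [ px ]) → to x ∣ [ subst P (sym (strictlyInverseʳ x)) px ] })
                      (λ { (i ∣ [ pi ]) → from i ∣ [ pi ] })
                      (λ { (i ∣ [ _ ]) → value-injective (strictlyInverseˡ i) })
                      (λ { (x ∣ [ _ ]) → value-injective (strictlyInverseʳ x) })

-- the (irrelevant) proof carried by a refinement, recomputed from a decision procedure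
witness : {P : A → Set p} → Decidable P → (x : Refinement A P) → P (value x)
witness P? (x ∣ [ px ]) = recompute (P? x) px

module Rewriting (T : Sig) where
  open Sig T using (O; M)
  open Over T

  Wireᵗ Nodeᵗ : TV → Set
  Wireᵗ x = Σ O λ X → x ≡ ob X
  Nodeᵗ x = Σ M λ f → x ≡ mor f

  wire≢bang : ∀ {x} → Wireᵗ x → x ≢ bang
  wire≢bang (_ , refl) ()

  node≢bang : ∀ {x} → Nodeᵗ x → x ≢ bang
  node≢bang (_ , refl) ()

  node-not-wire : ∀ {x} → Nodeᵗ x → ¬ Wireᵗ x
  node-not-wire (_ , refl) (_ , ())

  wire-or-node : ∀ {x} → x ≢ bang → Wireᵗ x ⊎ Nodeᵗ x
  wire-or-node {ob X}  _  = inj₁ (X , refl)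
  wire-or-node {mor f} _  = inj₂ (f , refl)
  wire-or-node {bang}  nb = ⊥-elim (nb refl)

  into-bang : ∀ te → ttgt te ≡ bang → tsrc te ≡ bang
  into-bang bangLoop _ = refl

  fixed-src : ∀ te → FixedT te → tsrc te ≢ bang
  fixed-src (inE _ _)  _ ()
  fixed-src (outE _ _) _ ()

  fixed-tgt : ∀ te → FixedT te → ttgt te ≢ bang
  fixed-tgt (inE _ _)  _ ()
  fixed-tgt (outE _ _) _ ()

  UEdge : (X : TGraph) → E X → Set
  UEdge X e = NonBang X (s X e) × NonBang X (t X e)

  Joins : (X : TGraph) → E X → V X → V X → Set
  Joins X e v w = ((s X e ≡ v) × (t X e ≡ w)) ⊎ ((s X e ≡ w) × (t X e ≡ v))

  module _ (X : TGraph) where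
    wire-nonbang : ∀ {v} → IsWire X v → NonBang X v
    wire-nonbang = wire≢bang

    node-nonbang : ∀ {v} → IsNode X v → NonBang X v
    node-nonbang = node≢bang

    bang-source : ∀ e → IsBang X (t X e) → IsBang X (s X e)
    bang-source e b = trans (τs X e) (into-bang (τE X e) (trans (sym (τt X e)) b))

    fixed-UEdge : ∀ e → Fixed X e → UEdge X e
    fixed-UEdge e fx = (λ b → fixed-src (τE X e) fx (trans (sym (τs X e)) b))
                     , (λ b → fixed-tgt (τE X e) fx (trans (sym (τt X e)) b))

  module _ {A B : TGraph} (f : Hom A B) where
    preserve : (Q : TV → Set) (v : V A) → Q (τV A v) → Q (τV B (fV f v))
    preserve Q v = subst Q (sym (fτV f v))

    reflect : (Q : TV → Set) (v : V A) → Q (τV B (fV f v)) → Q (τV A v)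
    reflect Q v = subst Q (fτV f v)

    preserve-fixed : ∀ e → Fixed A e → Fixed B (fE f e)
    preserve-fixed e = subst FixedT (sym (fτE f e))

    reflect-fixed : ∀ e → Fixed B (fE f e) → Fixed A e
    reflect-fixed e = subst FixedT (fτE f e)

    preserve-UEdge : ∀ e → UEdge A e → UEdge B (fE f e)
    preserve-UEdge e (ns , nt) =
      subst (NonBang B) (fs f e) (preserve (λ x → x ≢ bang) (s A e) ns) ,
      subst (NonBang B) (ft f e) (preserve (λ x → x ≢ bang) (t A e) nt)

  module Decide (X : TGraph) (fin : IsFinite X) where
    _≟V_ : (v w : V X) → Dec (v ≡ w)
    _≟V_ = finite-≟ (proj₁ fin)

    _≟E_ : (e e' : E X) → Dec (e ≡ e')
    _≟E_ = finite-≟ (proj₂ fin)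

    bang? : ∀ v → Dec (IsBang X v)
    bang? v with τV X v
    ... | ob _  = no λ ()
    ... | mor _ = no λ ()
    ... | bang  = yes refl

    nonBang? : ∀ v → Dec (NonBang X v)
    nonBang? v = ¬? (bang? v)

    wire? : ∀ v → Dec (IsWire X v)
    wire? v with τV X v
    ... | ob X' = yes (X' , refl)
    ... | mor _ = no λ ()
    ... | bang  = no λ ()

    UEdge? : ∀ e → Dec (UEdge X e)
    UEdge? e = nonBang? (s X e) ×-dec nonBang? (t X e)

    input? : ∀ v → Dec (IsInput X v)
    input? v = wire? v ×-dec finite-∀? (proj₂ fin)
      (λ e → nonBang? (s X e) →-dec (nonBang? (t X e) →-dec ¬? (t X e ≟V v)))

    output? : ∀ v → Dec (IsOutput X v)
    output? v = wire? v ×-dec finite-∀? (proj₂ fin)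
      (λ e → nonBang? (s X e) →-dec (nonBang? (t X e) →-dec ¬? (s X e ≟V v)))

    boundary? : ∀ v → Dec (BoundV X v)
    boundary? v = bang? v ⊎-dec (input? v ⊎-dec output? v)

    inV? : ∀ v → Dec (InV X v)
    inV? v = bang? v ⊎-dec input? v

    outV? : ∀ v → Dec (OutV X v)
    outV? v = bang? v ⊎-dec output? v

    imageV? : ∀ {Y} → IsFinite Y → (f : Hom Y X) → ∀ v → Dec (Σ (V Y) λ y → fV f y ≡ v)
    imageV? finY f v = finite-∃? (proj₁ finY) (λ y → fV f y ≟V v)

    imageE? : ∀ {Y} → IsFinite Y → (f : Hom Y X) → ∀ e → Dec (Σ (E Y) λ y → fE f y ≡ e)
    imageE? finY f e = finite-∃? (proj₂ finY) (λ y → fE f y ≟E e)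

    incoming-U : ∀ v → IsWire X v → ¬ IsInput X v → Σ (E X) λ e → UEdge X e × (t X e ≡ v)
    incoming-U v w ¬inp with finite-∃? (proj₂ fin) (λ e → UEdge? e ×-dec (t X e ≟V v))
    ... | yes found = found
    ... | no none = ⊥-elim (¬inp (w , λ e ns nt te → none (e , (ns , nt) , te)))

    outgoing-U : ∀ v → IsWire X v → ¬ IsOutput X v → Σ (E X) λ e → UEdge X e × (s X e ≡ v)
    outgoing-U v w ¬out with finite-∃? (proj₂ fin) (λ e → UEdge? e ×-dec (s X e ≟V v))
    ... | yes found = found
    ... | no none = ⊥-elim (¬out (w , λ e ns nt se → none (e , (ns , nt) , se)))

  module _ {K K' : TGraph} (f : Hom K K') where
    incident-map : ∀ {v} e → Incident K v e → Incident K' (fV f v) (fE f e)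
    incident-map e (inj₁ p) = inj₁ (trans (sym (fs f e)) (cong (fV f) p))
    incident-map e (inj₂ p) = inj₂ (trans (sym (ft f e)) (cong (fV f) p))

    incident-reflect : IsMono f → ∀ {v} e → Incident K' (fV f v) (fE f e) → Incident K v e
    incident-reflect (injV , _) e (inj₁ p) = inj₁ (injV _ _ (trans (fs f e) p))
    incident-reflect (injV , _) e (inj₂ p) = inj₂ (injV _ _ (trans (ft f e) p))

  -- NodeBij only sees fixed-arity edges, so it transfers along a mono f : K → K'
  -- which at v is surjective onto the fixed-arity edges incident to f(v)
  module NodeBijTransfer {K K' : TGraph} (f : Hom K K') (mono : IsMono f) (v : V K)
           (full : ∀ e' → Incident K' (fV f v) e' → Fixed K' e' → Σ (E K) λ e → fE f e ≡ e') where

    private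
      same-type-pos : ∀ te → (tsrc te ≡ τV K v) ⊎ (ttgt te ≡ τV K v) →
                      (tsrc te ≡ τV K' (fV f v)) ⊎ (ttgt te ≡ τV K' (fV f v))
      same-type-pos te (inj₁ p) = inj₁ (trans p (sym (fτV f v)))
      same-type-pos te (inj₂ p) = inj₂ (trans p (sym (fτV f v)))

      same-type-pos⁻ : ∀ te → (tsrc te ≡ τV K' (fV f v)) ⊎ (ttgt te ≡ τV K' (fV f v)) →
                       (tsrc te ≡ τV K v) ⊎ (ttgt te ≡ τV K v)
      same-type-pos⁻ te (inj₁ p) = inj₁ (trans p (fτV f v))
      same-type-pos⁻ te (inj₂ p) = inj₂ (trans p (fτV f v))

    nodeBij-up : NodeBij K v → NodeBij K' (fV f v)
    nodeBij-up (unique , exists) = unique' , exists'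
      where
        unique' : ∀ e₁ e₂ → Incident K' (fV f v) e₁ → Fixed K' e₁ → Incident K' (fV f v) e₂ →
                  Fixed K' e₂ → τE K' e₁ ≡ τE K' e₂ → e₁ ≡ e₂
        unique' e₁ e₂ i₁ x₁ i₂ x₂ τ≡ with full e₁ i₁ x₁ | full e₂ i₂ x₂
        ... | c₁ , refl | c₂ , refl =
          cong (fE f) (unique c₁ c₂ (incident-reflect f mono c₁ i₁) (reflect-fixed f c₁ x₁)
                                    (incident-reflect f mono c₂ i₂) (reflect-fixed f c₂ x₂)
                                    (trans (sym (fτE f c₁)) (trans τ≡ (fτE f c₂))))
        exists' : ∀ te → (tsrc te ≡ τV K' (fV f v)) ⊎ (ttgt te ≡ τV K' (fV f v)) → FixedT te →
                  Σ (E K') λ e → (Incident K' (fV f v) e × Fixed K' e) × (τE K' e ≡ te)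
        exists' te pos fx with exists te (same-type-pos⁻ te pos) fx
        ... | e , (inc , fe) , τe = fE f e , (incident-map f e inc , preserve-fixed f e fe) , trans (fτE f e) τe

    nodeBij-down : NodeBij K' (fV f v) → NodeBij K v
    nodeBij-down (unique , exists) = unique' , exists'
      where
        unique' : ∀ e₁ e₂ → Incident K v e₁ → Fixed K e₁ → Incident K v e₂ → Fixed K e₂ →
                  τE K e₁ ≡ τE K e₂ → e₁ ≡ e₂
        unique' e₁ e₂ i₁ x₁ i₂ x₂ τ≡ =
          proj₂ mono _ _ (unique (fE f e₁) (fE f e₂) (incident-map f e₁ i₁) (preserve-fixed f e₁ x₁)
                                 (incident-map f e₂ i₂) (preserve-fixed f e₂ x₂)
                                 (trans (fτE f e₁) (trans τ≡ (sym (fτE f e₂)))))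
        exists' : ∀ te → (tsrc te ≡ τV K v) ⊎ (ttgt te ≡ τV K v) → FixedT te →
                  Σ (E K) λ e → (Incident K v e × Fixed K e) × (τE K e ≡ te)
        exists' te pos fx with exists te (same-type-pos te pos) fx
        ... | e' , (inc , fe) , τe with full e' inc fe
        ... | e , refl = e , (incident-reflect f mono e inc , reflect-fixed f e fe) , trans (sym (fτE f e)) τe

  subIncl-mono : (X : TGraph) (PV : V X → Set) (PE : E X → Set)
                 (cl : ∀ e → PE e → PV (s X e) × PV (t X e)) → IsMono (subIncl X PV PE cl)
  subIncl-mono X PV PE cl = (λ _ _ → value-injective) , (λ _ _ → value-injective)

  -- the string-graph axioms of U(X), phrased directly in X
  record StringConditions (X : TGraph) : Set where
    field
      nodeBij : ∀ v → IsNode X v → NodeBij X v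
      wireIn  : ∀ v → IsWire X v → ∀ e e' → UEdge X e → UEdge X e' → t X e ≡ v → t X e' ≡ v → e ≡ e'
      wireOut : ∀ v → IsWire X v → ∀ e e' → UEdge X e → UEdge X e' → s X e ≡ v → s X e' ≡ v → e ≡ e'

  private
    relevant : {A : Set} → .(¬ A) → ¬ A
    relevant ¬a a = ⊥-elim-irr (¬a a)

    relevantU : ∀ X e → .(UEdge X e) → UEdge X e
    relevantU X e u = relevant (proj₁ u) , relevant (proj₂ u)

  module _ (X : TGraph) where
    private
      U-full : ∀ v e' → Incident X (fV (fullIncl X (NonBang X)) v) e' → Fixed X e' →
               Σ (E (U X)) λ e → value e ≡ e'
      U-full v e' _ fx = (e' ∣ [ fixed-UEdge X e' fx ]) , refl

      module Transfer (v : V (U X)) =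
        NodeBijTransfer (fullIncl X (NonBang X)) (subIncl-mono X (NonBang X) (UEdge X) (λ _ u → u)) v (U-full v)

    stringConditions : IsStringGraph (U X) → StringConditions X
    stringConditions sg = record
      { nodeBij = λ v nd → Transfer.nodeBij-up (v ∣ [ node-nonbang X nd ]) (nodeBij _ nd)
      ; wireIn  = λ v w e e' u u' p p' →
          cong value (wireIn (v ∣ [ wire-nonbang X w ]) w (e ∣ [ u ]) (e' ∣ [ u' ]) (value-injective p) (value-injective p'))
      ; wireOut = λ v w e e' u u' p p' →
          cong value (wireOut (v ∣ [ wire-nonbang X w ]) w (e ∣ [ u ]) (e' ∣ [ u' ]) (value-injective p) (value-injective p'))
      }
      where open IsStringGraph sg

    U-string : StringConditions X → IsStringGraph (U X)
    U-string sc = record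
      { typedOverGT = λ { (_ ∣ [ nb ]) → relevant nb }
      ; nodeBij = λ v nd → Transfer.nodeBij-down v (nodeBij (value v) nd)
      ; wireIn  = λ { v w (e ∣ [ u ]) (e' ∣ [ u' ]) p p' → value-injective
          (wireIn (value v) w e e' (relevantU X e u) (relevantU X e' u') (cong value p) (cong value p')) }
      ; wireOut = λ { v w (e ∣ [ u ]) (e' ∣ [ u' ]) p p' → value-injective
          (wireOut (value v) w e e' (relevantU X e u) (relevantU X e' u') (cong value p) (cong value p')) }
      }
      where
        open StringConditions sc

  module _ {K K' : TGraph} (f : Hom K K') where
    joins-map : ∀ {e v w} → Joins K e v w → Joins K' (fE f e) (fV f v) (fV f w)
    joins-map {e} (inj₁ (p , q)) = inj₁ (trans (sym (fs f e)) (cong (fV f) p) , trans (sym (ft f e)) (cong (fV f) q))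
    joins-map {e} (inj₂ (p , q)) = inj₂ (trans (sym (fs f e)) (cong (fV f) p) , trans (sym (ft f e)) (cong (fV f) q))

    edge-map : ∀ {a c} → EdgeBetween K a c → EdgeBetween K' (fV f a) (fV f c)
    edge-map (e , s≡ , t≡) = fE f e , trans (sym (fs f e)) (cong (fV f) s≡) , trans (sym (ft f e)) (cong (fV f) t≡)

    joins-reflect : IsMono f → ∀ {e v w} → Joins K' (fE f e) (fV f v) (fV f w) → Joins K e v w
    joins-reflect (injV , _) {e} (inj₁ (p , q)) = inj₁ (injV _ _ (trans (fs f e) p) , injV _ _ (trans (ft f e) q))
    joins-reflect (injV , _) {e} (inj₂ (p , q)) = inj₂ (injV _ _ (trans (fs f e) p) , injV _ _ (trans (ft f e) q))

  full-sub-string : (K : TGraph) → IsStringGraph K → (P : V K → Set) →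
                    (∀ v e → P v → Incident K v e → Fixed K e → P (s K e) × P (t K e)) →
                    IsStringGraph (fullG K P)
  full-sub-string K sg P closed = record
    { typedOverGT = λ v → typedOverGT (value v)
    ; nodeBij = λ v nd → NodeBijTransfer.nodeBij-down incl mono v (full v) (nodeBij (value v) nd)
    ; wireIn  = λ v w e e' p p' → value-injective (wireIn (value v) w (value e) (value e') (cong value p) (cong value p'))
    ; wireOut = λ v w e e' p p' → value-injective (wireOut (value v) w (value e) (value e') (cong value p) (cong value p'))
    }
    where
      open IsStringGraph sg
      incl = fullIncl K P
      mono = subIncl-mono K P (λ e → P (s K e) × P (t K e)) (λ _ p → p)
      full : ∀ v e' → Incident K (value v) e' → Fixed K e' → Σ (E (fullG K P)) λ e → value e ≡ e'
      full (v ∣ [ pv ]) e' inc fx = (e' ∣ [ closed v e' pv inc fx ]) , refl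

  -- openness of the box of b in U(X), phrased directly in X
  record BoxConditions (X : TGraph) (b : V X) : Set where
    field
      fixedClosed : ∀ v e → InBox X b v → Incident X v e → Fixed X e → InBox X b (s X e) × InBox X b (t X e)
      noWireExit  : ∀ v w e → InBox X b v → NonBang X v → ¬ InBox X b w → IsWire X w → UEdge X e → ¬ Joins X e v w

  module _ (X : TGraph) (b : V X) where
    private
      incl = fullIncl X (NonBang X)
      mono = subIncl-mono X (NonBang X) (UEdge X) (λ _ u → u)

      incident-nonbang : ∀ {v} e → Incident X v e → UEdge X e → NonBang X v
      incident-nonbang e (inj₁ refl) (ns , _) = ns
      incident-nonbang e (inj₂ refl) (_ , nt) = nt

    boxConditions : IsOpenFull (U X) (λ x → InBox X b (value x)) → BoxConditions X b
    boxConditions op = record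
      { fixedClosed = λ v e inb inc fx →
          let u = fixed-UEdge X e fx
              v′ = v ∣ [ incident-nonbang e inc u ]
          in fixedInside v′ (e ∣ [ u ]) inb (incident-reflect incl mono {v′} (e ∣ [ u ]) inc) fx
      ; noWireExit  = λ v w e inb nb ¬inb ww u joins →
          let v′ = v ∣ [ nb ]
              w′ = w ∣ [ wire-nonbang X ww ]
          in noWireAdj v′ w′ inb ¬inb ww ((e ∣ [ u ]) , joins-reflect incl mono {e ∣ [ u ]} {v′} {w′} joins)
      }
      where open IsOpenFull op

    box-open : IsStringGraph (U X) → BoxConditions X b → IsOpenFull (U X) (λ x → InBox X b (value x))
    box-open sg bc = record
      { stringSub = full-sub-string (U X) sg _ inside
      ; noWireAdj = λ { (v ∣ [ nb ]) w inb ¬inb ww ((e ∣ [ u ]) , joins) →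
          noWireExit v (value w) e inb (relevant nb) ¬inb ww (relevantU X e u) (joins-map incl {e ∣ [ u ]} {v ∣ [ nb ]} {w} joins) }
      ; fixedInside = inside
      }
      where
        open BoxConditions bc
        inside : ∀ v e → InBox X b (value v) → Incident (U X) v e → Fixed (U X) e →
                 InBox X b (s X (value e)) × InBox X b (t X (value e))
        inside v e inb inc = fixedClosed (value v) (value e) inb (incident-map incl e inc)

  -- Pushout complement of i : I → L along a mono m : L → G: delete from G the
  -- image under m of everything of L outside the image of i.  It is a graph
  -- as soon as no kept edge touches a deleted vertex (the dangling condition).
  module Complement {I L G : TGraph} (i : Hom I L) (m : Hom L G) (m-mono : IsMono m)
                    (finI : IsFinite I) (finL : IsFinite L) (finG : IsFinite G) where
    private
      module DL = Decide L finL
      module DG = Decide G finG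

    DeletedV : V G → Set
    DeletedV v = Σ (V L) λ x → (fV m x ≡ v) × ¬ (Σ (V I) λ z → fV i z ≡ x)

    DeletedE : E G → Set
    DeletedE e = Σ (E L) λ x → (fE m x ≡ e) × ¬ (Σ (E I) λ z → fE i z ≡ x)

    deletedV? : ∀ v → Dec (DeletedV v)
    deletedV? v = finite-∃? (proj₁ finL) λ x → (fV m x DG.≟V v) ×-dec ¬? (DL.imageV? finI i x)

    deletedE? : ∀ e → Dec (DeletedE e)
    deletedE? e = finite-∃? (proj₂ finL) λ x → (fE m x DG.≟E e) ×-dec ¬? (DL.imageE? finI i x)

    kept-imageV : ∀ z → ¬ DeletedV (fV m (fV i z))
    kept-imageV z (x , mx≡ , ¬img) = ¬img (z , proj₁ m-mono _ _ (sym mx≡))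

    kept-imageE : ∀ z → ¬ DeletedE (fE m (fE i z))
    kept-imageE z (x , mx≡ , ¬img) = ¬img (z , proj₂ m-mono _ _ (sym mx≡))

    module Construction (dangling : ∀ e → ¬ DeletedE e → ¬ DeletedV (s G e) × ¬ DeletedV (t G e)) where

      D : TGraph
      D = subG G (¬_ ∘ DeletedV) (¬_ ∘ DeletedE) dangling

      g : Hom D G
      g = subIncl G (¬_ ∘ DeletedV) (¬_ ∘ DeletedE) dangling

      d : Hom I D
      d = record
        { fV  = λ z → fV m (fV i z) ∣ [ kept-imageV z ]
        ; fE  = λ z → fE m (fE i z) ∣ [ kept-imageE z ]
        ; fs  = λ z → value-injective (fs (m ∘H i) z)
        ; ft  = λ z → value-injective (ft (m ∘H i) z)
        ; fτV = fτV (m ∘H i)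
        ; fτE = fτE (m ∘H i)
        }

      g∘d : g ∘H d ≈H m ∘H i
      g∘d = (λ _ → refl) , (λ _ → refl)

      D-finite : IsFinite D
      D-finite = finite-refine (proj₁ finG) (¬? ∘ deletedV?) , finite-refine (proj₂ finG) (¬? ∘ deletedE?)

      pushout : IsPushout i d m g
      pushout = g∘d , universal
        where
          universal : ∀ Q (x : Hom L Q) (y : Hom D Q) → x ∘H i ≈H y ∘H d →
                      Σ (Hom G Q) λ u → ((u ∘H m ≈H x) × (u ∘H g ≈H y)) ×
                        (∀ u' → u' ∘H m ≈H x → u' ∘H g ≈H y → u' ≈H u)
          universal Q x y (xi≡ydV , xi≡ydE) = u , (u∘m , u∘g) , unique
            where
              keptOfV : ∀ v → ¬ (Σ (V L) λ l → fV m l ≡ v) → ¬ DeletedV v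
              keptOfV v ∉m (l , ml≡ , _) = ∉m (l , ml≡)
              keptOfE : ∀ e → ¬ (Σ (E L) λ l → fE m l ≡ e) → ¬ DeletedE e
              keptOfE e ∉m (l , ml≡ , _) = ∉m (l , ml≡)

              coverV : (P : V G → Set) → (∀ l → P (fV m l)) → (∀ (w : V D) → P (value w)) → ∀ v → P v
              coverV P onM onG v with DG.imageV? finL m v
              ... | yes (l , refl) = onM l
              ... | no ∉m = onG (v ∣ [ keptOfV v ∉m ])
              coverE : (P : E G → Set) → (∀ l → P (fE m l)) → (∀ (w : E D) → P (value w)) → ∀ e → P e
              coverE P onM onG e with DG.imageE? finL m e
              ... | yes (l , refl) = onM l
              ... | no ∉m = onG (e ∣ [ keptOfE e ∉m ])

              uV' : ∀ v → Dec (Σ (V L) λ l → fV m l ≡ v) → V Q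
              uV' v (yes (l , _)) = fV x l
              uV' v (no ∉m) = fV y (v ∣ [ keptOfV v ∉m ])
              uE' : ∀ e → Dec (Σ (E L) λ l → fE m l ≡ e) → E Q
              uE' e (yes (l , _)) = fE x l
              uE' e (no ∉m) = fE y (e ∣ [ keptOfE e ∉m ])
              uV : V G → V Q
              uV v = uV' v (DG.imageV? finL m v)
              uE : E G → E Q
              uE e = uE' e (DG.imageE? finL m e)

              u∘mV : ∀ l → uV (fV m l) ≡ fV x l
              u∘mV l with DG.imageV? finL m (fV m l)
              ... | yes (l' , ml'≡) = cong (fV x) (proj₁ m-mono _ _ ml'≡)
              ... | no ∉m = contradiction (l , refl) ∉m
              u∘mE : ∀ l → uE (fE m l) ≡ fE x l
              u∘mE l with DG.imageE? finL m (fE m l)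
              ... | yes (l' , ml'≡) = cong (fE x) (proj₂ m-mono _ _ ml'≡)
              ... | no ∉m = contradiction (l , refl) ∉m

              -- a kept vertex in the image of m comes from the image of i, where x and y agree
              u∘gV : ∀ w → uV (value w) ≡ fV y w
              u∘gV (v ∣ [ kept ]) with DG.imageV? finL m v
              ... | no _ = refl
              ... | yes (l , ml≡) with DL.imageV? finI i l
              ...   | no ∉i = ⊥-elim-irr (kept (l , ml≡ , ∉i))
              ...   | yes (z , refl) = trans (xi≡ydV z) (cong (fV y) (value-injective ml≡))
              u∘gE : ∀ w → uE (value w) ≡ fE y w
              u∘gE (e ∣ [ kept ]) with DG.imageE? finL m e
              ... | no _ = refl
              ... | yes (l , ml≡) with DL.imageE? finI i l
              ...   | no ∉i = ⊥-elim-irr (kept (l , ml≡ , ∉i))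
              ...   | yes (z , refl) = trans (xi≡ydE z) (cong (fE y) (value-injective ml≡))

              u : Hom G Q
              u = record
                { fV  = uV
                ; fE  = uE
                ; fs  = coverE (λ e → uV (s G e) ≡ s Q (uE e))
                          (λ l → trans (cong uV (sym (fs m l))) (trans (u∘mV (s L l)) (trans (fs x l) (cong (s Q) (sym (u∘mE l))))))
                          (λ w → trans (u∘gV (s D w)) (trans (fs y w) (cong (s Q) (sym (u∘gE w)))))
                ; ft  = coverE (λ e → uV (t G e) ≡ t Q (uE e))
                          (λ l → trans (cong uV (sym (ft m l))) (trans (u∘mV (t L l)) (trans (ft x l) (cong (t Q) (sym (u∘mE l))))))
                          (λ w → trans (u∘gV (t D w)) (trans (ft y w) (cong (t Q) (sym (u∘gE w)))))
                ; fτV = coverV (λ v → τV Q (uV v) ≡ τV G v)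
                          (λ l → trans (cong (τV Q) (u∘mV l)) (trans (fτV x l) (sym (fτV m l))))
                          (λ w → trans (cong (τV Q) (u∘gV w)) (fτV y w))
                ; fτE = coverE (λ e → τE Q (uE e) ≡ τE G e)
                          (λ l → trans (cong (τE Q) (u∘mE l)) (trans (fτE x l) (sym (fτE m l))))
                          (λ w → trans (cong (τE Q) (u∘gE w)) (fτE y w))
                }

              u∘m : u ∘H m ≈H x
              u∘m = u∘mV , u∘mE
              u∘g : u ∘H g ≈H y
              u∘g = u∘gV , u∘gE

              unique : ∀ u' → u' ∘H m ≈H x → u' ∘H g ≈H y → u' ≈H u
              unique u' (u'mV , u'mE) (u'gV , u'gE) =
                coverV (λ v → fV u' v ≡ uV v) (λ l → trans (u'mV l) (sym (u∘mV l))) (λ w → trans (u'gV w) (sym (u∘gV w))) ,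
                coverE (λ e → fE u' e ≡ uE e) (λ l → trans (u'mE l) (sym (u∘mE l))) (λ w → trans (u'gE w) (sym (u∘gE w)))

  -- Pushout of d : I → D along a mono i : I → R with decidable image: H is D
  -- together with the part of R outside the image of i.
  module Glue {I D R : TGraph} (d : Hom I D) (i : Hom I R) (i-mono : IsMono i)
              (imageV? : ∀ y → Dec (Σ (V I) λ z → fV i z ≡ y))
              (imageE? : ∀ e → Dec (Σ (E I) λ z → fE i z ≡ e)) where

    NewV : Set
    NewV = Refinement (V R) λ y → ¬ (Σ (V I) λ z → fV i z ≡ y)

    NewE : Set
    NewE = Refinement (E R) λ e → ¬ (Σ (E I) λ z → fE i z ≡ e)

    private
      rV' : ∀ y → Dec (Σ (V I) λ z → fV i z ≡ y) → V D ⊎ NewV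
      rV' y (yes (z , _)) = inj₁ (fV d z)
      rV' y (no ∉i) = inj₂ (y ∣ [ ∉i ])

      rE' : ∀ e → Dec (Σ (E I) λ z → fE i z ≡ e) → E D ⊎ NewE
      rE' e (yes (z , _)) = inj₁ (fE d z)
      rE' e (no ∉i) = inj₂ (e ∣ [ ∉i ])

    rV : V R → V D ⊎ NewV
    rV y = rV' y (imageV? y)

    rE : E R → E D ⊎ NewE
    rE e = rE' e (imageE? e)

    rV-image : ∀ z → rV (fV i z) ≡ inj₁ (fV d z)
    rV-image z with imageV? (fV i z)
    ... | yes (z' , iz'≡) = cong (inj₁ ∘ fV d) (proj₁ i-mono _ _ iz'≡)
    ... | no ∉i = contradiction (z , refl) ∉i

    rE-image : ∀ z → rE (fE i z) ≡ inj₁ (fE d z)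
    rE-image z with imageE? (fE i z)
    ... | yes (z' , iz'≡) = cong (inj₁ ∘ fE d) (proj₂ i-mono _ _ iz'≡)
    ... | no ∉i = contradiction (z , refl) ∉i

    rV-new : ∀ y .(∉i : ¬ (Σ (V I) λ z → fV i z ≡ y)) → rV y ≡ inj₂ (y ∣ [ ∉i ])
    rV-new y ∉i with imageV? y
    ... | yes found = ⊥-elim-irr (∉i found)
    ... | no _ = refl

    rE-new : ∀ e .(∉i : ¬ (Σ (E I) λ z → fE i z ≡ e)) → rE e ≡ inj₂ (e ∣ [ ∉i ])
    rE-new e ∉i with imageE? e
    ... | yes found = ⊥-elim-irr (∉i found)
    ... | no _ = refl

    rV-old : ∀ y v → rV y ≡ inj₁ v → Σ (V I) λ z → (fV i z ≡ y) × (fV d z ≡ v)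
    rV-old y v r≡ with imageV? y
    rV-old y v refl | yes (z , iz≡) = z , iz≡ , refl

    private
      τH : V D ⊎ NewV → TV
      τH = either (τV D) (τV R ∘ value)

      τEH : E D ⊎ NewE → TE
      τEH = either (τE D) (τE R ∘ value)

      rτV : ∀ y → τH (rV y) ≡ τV R y
      rτV y with imageV? y
      ... | yes (z , refl) = trans (fτV d z) (sym (fτV i z))
      ... | no _ = refl

      rτE : ∀ e → τEH (rE e) ≡ τE R e
      rτE e with imageE? e
      ... | yes (z , refl) = trans (fτE d z) (sym (fτE i z))
      ... | no _ = refl

      rs : ∀ e → rV (s R e) ≡ either (inj₁ ∘ s D) (rV ∘ s R ∘ value) (rE e)
      rs e with imageE? e
      ... | yes (z , refl) = trans (cong rV (sym (fs i z))) (trans (rV-image (s I z)) (cong inj₁ (fs d z)))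
      ... | no _ = refl

      rt : ∀ e → rV (t R e) ≡ either (inj₁ ∘ t D) (rV ∘ t R ∘ value) (rE e)
      rt e with imageE? e
      ... | yes (z , refl) = trans (cong rV (sym (ft i z))) (trans (rV-image (t I z)) (cong inj₁ (ft d z)))
      ... | no _ = refl

    H : TGraph
    H = record
      { V  = V D ⊎ NewV
      ; E  = E D ⊎ NewE
      ; s  = either (inj₁ ∘ s D) (rV ∘ s R ∘ value)
      ; t  = either (inj₁ ∘ t D) (rV ∘ t R ∘ value)
      ; τV = τH
      ; τE = τEH
      ; τs = λ { (inj₁ e) → τs D e ; (inj₂ e) → trans (rτV (s R (value e))) (τs R (value e)) }
      ; τt = λ { (inj₁ e) → τt D e ; (inj₂ e) → trans (rτV (t R (value e))) (τt R (value e)) }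
      }

    h : Hom D H
    h = record { fV = inj₁ ; fE = inj₁ ; fs = λ _ → refl ; ft = λ _ → refl ; fτV = λ _ → refl ; fτE = λ _ → refl }

    r : Hom R H
    r = record { fV = rV ; fE = rE ; fs = rs ; ft = rt ; fτV = rτV ; fτE = rτE }

    h∘d : h ∘H d ≈H r ∘H i
    h∘d = (λ z → sym (rV-image z)) , (λ z → sym (rE-image z))

    h-mono : IsMono h
    h-mono = (λ _ _ → inj₁-injective) , (λ _ _ → inj₁-injective)

    r-mono : IsMono d → IsMono r
    r-mono (d-injV , d-injE) = injV , injE
      where
        injV : ∀ y y' → rV y ≡ rV y' → y ≡ y'
        injV y y' r≡ with imageV? y | imageV? y'
        ... | yes (z , refl) | yes (z' , refl) = cong (fV i) (d-injV _ _ (inj₁-injective r≡))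
        ... | no _ | no _ = cong value (inj₂-injective r≡)
        injV y y' () | yes _ | no _
        injV y y' () | no _ | yes _
        injE : ∀ e e' → rE e ≡ rE e' → e ≡ e'
        injE e e' r≡ with imageE? e | imageE? e'
        ... | yes (z , refl) | yes (z' , refl) = cong (fE i) (d-injE _ _ (inj₁-injective r≡))
        ... | no _ | no _ = cong value (inj₂-injective r≡)
        injE e e' () | yes _ | no _
        injE e e' () | no _ | yes _

    H-finite : IsFinite D → IsFinite R → IsFinite H
    H-finite finD finR = finite-⊎ (proj₁ finD) (finite-refine (proj₁ finR) (¬? ∘ imageV?)) ,
                         finite-⊎ (proj₂ finD) (finite-refine (proj₂ finR) (¬? ∘ imageE?))

    -- a map out of H is a map out of D together with one out of the new part of R
    pushout : IsPushout d i h r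
    pushout = h∘d , universal
      where
        universal : ∀ Q (x : Hom D Q) (y : Hom R Q) → x ∘H d ≈H y ∘H i →
                    Σ (Hom H Q) λ u → ((u ∘H h ≈H x) × (u ∘H r ≈H y)) ×
                      (∀ u' → u' ∘H h ≈H x → u' ∘H r ≈H y → u' ≈H u)
        universal Q x y (xd≡yiV , xd≡yiE) = u , (((λ _ → refl) , (λ _ → refl)) , (u∘rV , u∘rE)) , unique
          where
            uV : V H → V Q
            uV = either (fV x) (fV y ∘ value)
            uE : E H → E Q
            uE = either (fE x) (fE y ∘ value)

            u∘rV : ∀ w → uV (rV w) ≡ fV y w
            u∘rV w with imageV? w
            ... | yes (z , refl) = xd≡yiV z
            ... | no _ = refl
            u∘rE : ∀ w → uE (rE w) ≡ fE y w
            u∘rE w with imageE? w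
            ... | yes (z , refl) = xd≡yiE z
            ... | no _ = refl

            u : Hom H Q
            u = record
              { fV  = uV
              ; fE  = uE
              ; fs  = λ { (inj₁ e) → fs x e ; (inj₂ e) → trans (u∘rV (s R (value e))) (fs y (value e)) }
              ; ft  = λ { (inj₁ e) → ft x e ; (inj₂ e) → trans (u∘rV (t R (value e))) (ft y (value e)) }
              ; fτV = λ { (inj₁ v) → fτV x v ; (inj₂ v) → fτV y (value v) }
              ; fτE = λ { (inj₁ e) → fτE x e ; (inj₂ e) → fτE y (value e) }
              }

            unique : ∀ u' → u' ∘H h ≈H x → u' ∘H r ≈H y → u' ≈H u
            unique u' (u'hV , u'hE) (u'rV , u'rE) = uniqueV , uniqueE
              where
                uniqueV : ∀ v → fV u' v ≡ uV v
                uniqueV (inj₁ v) = u'hV v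
                uniqueV (inj₂ (w ∣ [ ∉i ])) = trans (cong (fV u') (sym (rV-new w ∉i))) (u'rV w)
                uniqueE : ∀ e → fE u' e ≡ uE e
                uniqueE (inj₁ e) = u'hE e
                uniqueE (inj₂ (w ∣ [ ∉i ])) = trans (cong (fE u') (sym (rE-new w ∉i))) (u'rE w)

  module Embedding {D G : TGraph} (g : Hom D G) (g-mono : IsMono g) (reflBox : ReflectsBoxContainment g)
                   (node-full : ∀ v → IsNode D v → ∀ e' → Incident G (fV g v) e' → Fixed G e' →
                                Σ (E D) λ e → fE g e ≡ e')
                   (bgG : IsBangGraph G) where
    private
      module BG = IsBangGraph bgG
      module StrG = StringConditions (stringConditions G BG.stringU)
      injV : ∀ v v' → fV g v ≡ fV g v' → v ≡ v'
      injV = proj₁ g-mono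
      injE : ∀ e e' → fE g e ≡ fE g e' → e ≡ e'
      injE = proj₂ g-mono

    g-bang : ∀ v → IsBang D v → IsBang G (fV g v)
    g-bang = preserve g (_≡ bang)

    edge-lift : ∀ a c → IsBang D a → EdgeBetween G (fV g a) (fV g c) → EdgeBetween D a c
    edge-lift a c ba (e' , s≡ , t≡) with reflBox e' c (subst (IsBang G) (sym s≡) (g-bang a ba)) t≡
    ... | e , refl = e , injV _ _ (trans (fs g e) s≡) , injV _ _ (trans (ft g e) t≡)

    string : StringConditions D
    string = record
      { nodeBij = λ v nd → NodeBijTransfer.nodeBij-down g g-mono v (node-full v nd)
                             (StrG.nodeBij (fV g v) (preserve g Nodeᵗ v nd))
      ; wireIn  = λ v w e e' u u' t≡ t≡' → injE _ _ (StrG.wireIn (fV g v) (preserve g Wireᵗ v w) (fE g e) (fE g e')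
                    (preserve-UEdge g e u) (preserve-UEdge g e' u')
                    (trans (sym (ft g e)) (cong (fV g) t≡)) (trans (sym (ft g e')) (cong (fV g) t≡')))
      ; wireOut = λ v w e e' u u' s≡ s≡' → injE _ _ (StrG.wireOut (fV g v) (preserve g Wireᵗ v w) (fE g e) (fE g e')
                    (preserve-UEdge g e u) (preserve-UEdge g e' u')
                    (trans (sym (fs g e)) (cong (fV g) s≡)) (trans (sym (fs g e')) (cong (fV g) s≡')))
      }

    box : ∀ b → IsBang D b → BoxConditions D b
    box b bb = record
      { fixedClosed = λ v e inb inc fx →
          let (ps , pt) = fixedClosed (fV g v) (fE g e) (edge-map g inb) (incident-map g e inc) (preserve-fixed g e fx)
          in edge-lift b (s D e) bb (subst (EdgeBetween G (fV g b)) (sym (fs g e)) ps) ,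
             edge-lift b (t D e) bb (subst (EdgeBetween G (fV g b)) (sym (ft g e)) pt)
      ; noWireExit  = λ v w e inb nbv ∉inb ww u joins →
          noWireExit (fV g v) (fV g w) (fE g e) (edge-map g inb) (preserve g (_≢ bang) v nbv)
                     (λ inb' → ∉inb (edge-lift b w bb inb')) (preserve g Wireᵗ w ww) (preserve-UEdge g e u)
                     (joins-map g joins)
      }
      where open BoxConditions (boxConditions G (fV g b) (BG.boxOpen (fV g b) (g-bang b bb)))

    bang-graph : IsFinite D → IsBangGraph D
    bang-graph finD = record
      { finite   = finD
      ; stringU  = U-string D string
      ; βsimple  = λ e e' bs bt s≡ t≡ → injE _ _ (BG.βsimple (fE g e) (fE g e')
                     (subst (IsBang G) (fs g e) (g-bang (s D e) bs))
                     (subst (IsBang G) (ft g e) (g-bang (t D e) bt))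
                     (trans (sym (fs g e)) (trans (cong (fV g) s≡) (fs g e')))
                     (trans (sym (ft g e)) (trans (cong (fV g) t≡) (ft g e'))))
      ; βrefl    = λ b bb → edge-lift b b bb (BG.βrefl (fV g b) (g-bang b bb))
      ; βtrans   = λ a b c ba bb bc ab bc' → edge-lift a c ba
                     (BG.βtrans _ _ _ (g-bang a ba) (g-bang b bb) (g-bang c bc) (edge-map g ab) (edge-map g bc'))
      ; βantisym = λ a b ba bb ab ba' → injV _ _ (BG.βantisym _ _ (g-bang a ba) (g-bang b bb) (edge-map g ab) (edge-map g ba'))
      ; boxOpen  = λ b bb → box-open D b (U-string D string) (box b bb)
      ; boxNest  = λ b b' bb bb' inb v inb' → edge-lift b v bb
                     (BG.boxNest _ _ (g-bang b bb) (g-bang b' bb') (edge-map g inb) (fV g v) (edge-map g inb'))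
      }

  -- A leg i : I → X of a rule, with I ≅ Bound_!(X) such that i restricts to the
  -- inclusions on In_! and Out_!, is an isomorphism of I onto Bound_!(X).
  module RuleLeg {X I : TGraph} (finX : IsFinite X) (i : Hom I X) (φ : Hom (Bound! X) I) (φ-iso : IsIso φ)
                 (i∘j : i ∘H (φ ∘H inclInB X) ≈H inclInL X) (i∘k : i ∘H (φ ∘H inclOutB X) ≈H inclOutL X) where
    open Decide X finX

    private
      ψ : Hom I (Bound! X)
      ψ = proj₁ φ-iso

      φ∘ψV : ∀ z → fV φ (fV ψ z) ≡ z
      φ∘ψV = proj₁ (proj₂ (proj₂ φ-iso))

      φ∘ψE : ∀ z → fE φ (fE ψ z) ≡ z
      φ∘ψE = proj₂ (proj₂ (proj₂ φ-iso))

      bang-boundary? : ∀ e → Dec (IsBang X (s X e) × BoundV X (t X e))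
      bang-boundary? e = bang? (s X e) ×-dec boundary? (t X e)

    -- every boundary vertex/edge lies in In_! or Out_!, so i ∘ φ is the inclusion
    i∘φV : ∀ β → fV i (fV φ β) ≡ value β
    i∘φV β@(v ∣ _) with witness boundary? β
    ... | inj₁ b         = proj₁ i∘j (v ∣ [ inj₁ b ])
    ... | inj₂ (inj₁ io) = proj₁ i∘j (v ∣ [ inj₂ io ])
    ... | inj₂ (inj₂ io) = proj₁ i∘k (v ∣ [ inj₂ io ])

    i∘φE : ∀ β → fE i (fE φ β) ≡ value β
    i∘φE β@(e ∣ _) with witness bang-boundary? β
    ... | bs , inj₁ b         = proj₂ i∘j (e ∣ [ inj₁ bs , inj₁ b ])
    ... | bs , inj₂ (inj₁ io) = proj₂ i∘j (e ∣ [ inj₁ bs , inj₂ io ])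
    ... | bs , inj₂ (inj₂ io) = proj₂ i∘k (e ∣ [ inj₁ bs , inj₂ io ])

    -- hence i is the inclusion composed with the inverse ψ of φ, so it is injective
    i-viaψV : ∀ z → fV i z ≡ value (fV ψ z)
    i-viaψV z = trans (cong (fV i) (sym (φ∘ψV z))) (i∘φV (fV ψ z))

    i-viaψE : ∀ z → fE i z ≡ value (fE ψ z)
    i-viaψE z = trans (cong (fE i) (sym (φ∘ψE z))) (i∘φE (fE ψ z))

    i-mono : IsMono i
    i-mono = (λ z z' iz≡ → trans (sym (φ∘ψV z)) (trans (cong (fV φ) (value-injective
                             (trans (sym (i-viaψV z)) (trans iz≡ (i-viaψV z'))))) (φ∘ψV z'))) ,
             (λ z z' iz≡ → trans (sym (φ∘ψE z)) (trans (cong (fE φ) (value-injective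
                             (trans (sym (i-viaψE z)) (trans iz≡ (i-viaψE z'))))) (φ∘ψE z')))

    i-boundary : ∀ z → BoundV X (fV i z)
    i-boundary z = subst (BoundV X) (sym (i-viaψV z)) (witness boundary? (fV ψ z))

    i-bang-edge : ∀ z → IsBang X (s X (fE i z))
    i-bang-edge z = subst (IsBang X ∘ s X) (sym (i-viaψE z)) (proj₁ (witness bang-boundary? (fE ψ z)))

    boundary-image : ∀ v → BoundV X v → Σ (V I) λ z → fV i z ≡ v
    boundary-image v p = fV φ (v ∣ [ p ]) , i∘φV (v ∣ [ p ])

    bang-edge-image : ∀ e → IsBang X (s X e) → BoundV X (t X e) → Σ (E I) λ z → fE i z ≡ e
    bang-edge-image e b p = fE φ (e ∣ [ b , p ]) , i∘φE (e ∣ [ b , p ])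

    φ∘i : ∀ z .p → fV φ (fV i z ∣ [ p ]) ≡ z
    φ∘i z p = proj₁ i-mono _ _ (i∘φV (fV i z ∣ [ p ]))

    i-no-node : ∀ z → ¬ IsNode I z
    i-no-node z nd with i-boundary z | preserve i Nodeᵗ z nd
    ... | inj₁ b         | nd' = node≢bang nd' b
    ... | inj₂ (inj₁ io) | nd' = node-not-wire nd' (proj₁ io)
    ... | inj₂ (inj₂ io) | nd' = node-not-wire nd' (proj₁ io)

  module Rewrite {L I R G : TGraph} (i₁ : Hom I L) (i₂ : Hom I R) (rule : IsRewriteRule i₁ i₂)
                   (m : Hom L G) (matching : IsMatching m) where
    open IsRewriteRule rule
    open IsMatching matching using (bgG; mono; reflBox; locIso)

    finL : IsFinite L
    finL = IsBangGraph.finite bgL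
    finI : IsFinite I
    finI = IsBangGraph.finite bgI
    finR : IsFinite R
    finR = IsBangGraph.finite bgR
    finG : IsFinite G
    finG = IsBangGraph.finite bgG

    module LegL = RuleLeg finL i₁ φL φL-iso i₁j₁ i₁k₁
    module LegR = RuleLeg finR i₂ φR φR-iso i₂j₂ i₂k₂
    module DecL = Decide L finL
    module DecR = Decide R finR
    module DecG = Decide G finG
    module StrG = StringConditions (stringConditions G (IsBangGraph.stringU bgG))

    bang-across : ∀ z → IsBang L (fV i₁ z) → IsBang R (fV i₂ z)
    bang-across z b = preserve i₂ (_≡ bang) z (reflect i₁ (_≡ bang) z b)

    -- a vertex of I which is an input (output) in R is also an input (output) in L,
    -- because j₂ ∘ φ_I = j₁ (k₂ ∘ φ_O = k₁) and the legs restrict to inclusions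
    input-in-L : ∀ z → IsInput R (fV i₂ z) → IsInput L (fV i₁ z)
    input-in-L z inp = from-In! (witness DecL.inV? w)
      where
        open ≡-Reasoning
        w : V (In! L)
        w = fV (proj₁ φI-iso) (fV i₂ z ∣ [ inj₂ inp ])
        j₁w≡z : fV j₁ w ≡ z
        j₁w≡z = begin
          fV j₁ w                               ≡⟨ sym (proj₁ j₂φI w) ⟩
          fV j₂ (fV φI w)                       ≡⟨ cong (fV j₂) (proj₁ (proj₂ (proj₂ φI-iso)) _) ⟩
          fV φR (fV i₂ z ∣ [ inj₂ (inj₁ inp) ]) ≡⟨ LegR.φ∘i z _ ⟩
          z                                     ∎
        i₁z≡w : fV i₁ z ≡ value w
        i₁z≡w = trans (cong (fV i₁) (sym j₁w≡z)) (proj₁ i₁j₁ w)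
        from-In! : InV L (value w) → IsInput L (fV i₁ z)
        from-In! (inj₁ b) = ⊥-elim (wire≢bang (proj₁ inp) (bang-across z (subst (IsBang L) (sym i₁z≡w) b)))
        from-In! (inj₂ inp') = subst (IsInput L) (sym i₁z≡w) inp'

    output-in-L : ∀ z → IsOutput R (fV i₂ z) → IsOutput L (fV i₁ z)
    output-in-L z out = from-Out! (witness DecL.outV? w)
      where
        open ≡-Reasoning
        w : V (Out! L)
        w = fV (proj₁ φO-iso) (fV i₂ z ∣ [ inj₂ out ])
        k₁w≡z : fV k₁ w ≡ z
        k₁w≡z = begin
          fV k₁ w                               ≡⟨ sym (proj₁ k₂φO w) ⟩
          fV k₂ (fV φO w)                       ≡⟨ cong (fV k₂) (proj₁ (proj₂ (proj₂ φO-iso)) _) ⟩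
          fV φR (fV i₂ z ∣ [ inj₂ (inj₂ out) ]) ≡⟨ LegR.φ∘i z _ ⟩
          z                                     ∎
        i₁z≡w : fV i₁ z ≡ value w
        i₁z≡w = trans (cong (fV i₁) (sym k₁w≡z)) (proj₁ i₁k₁ w)
        from-Out! : OutV L (value w) → IsOutput L (fV i₁ z)
        from-Out! (inj₁ b) = ⊥-elim (wire≢bang (proj₁ out) (bang-across z (subst (IsBang L) (sym i₁z≡w) b)))
        from-Out! (inj₂ out') = subst (IsOutput L) (sym i₁z≡w) out'

    ImageV₁ : V L → Set
    ImageV₁ x = Σ (V I) λ z → fV i₁ z ≡ x

    non-boundary : ∀ x → ¬ ImageV₁ x → ¬ BoundV L x
    non-boundary x ∉i₁ b = ∉i₁ (LegL.boundary-image x b)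

    -- For edges from a !-vertex this is reflection of
    -- !-box containment, at node-vertices it is local isomorphism, and at
    -- wire-vertices (which are neither inputs nor outputs of L) the unique incoming
    -- and outgoing U-edge of a wire in G is already the image of one in L.
    dangling : ∀ x → ¬ ImageV₁ x → ∀ e → Incident G (fV m x) e → Σ (E L) λ l → fE m l ≡ e
    dangling x ∉i₁ e inc with DecG.bang? (s G e)
    ... | yes bs = bang-edge inc
      where
        bang-edge : Incident G (fV m x) e → Σ (E L) λ l → fE m l ≡ e
        bang-edge (inj₁ se≡) = ⊥-elim (non-boundary x ∉i₁ (inj₁ (reflect m (_≡ bang) x (subst (IsBang G) se≡ bs))))
        bang-edge (inj₂ te≡) = reflBox e x bs te≡
    ... | no nbs = at-kind (wire-or-node nbx) inc
      where
        nbx : NonBang L x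
        nbx b = non-boundary x ∉i₁ (inj₁ b)
        uE : UEdge G e
        uE = nbs , (λ bt → nbs (bang-source G e bt))
        at-kind : IsWire L x ⊎ IsNode L x → Incident G (fV m x) e → Σ (E L) λ l → fE m l ≡ e
        at-kind (inj₂ nd) inc' with proj₂ (locIso x nd) e (uE , inc')
        ... | l , _ , ml≡ = l , ml≡
        at-kind (inj₁ w) (inj₂ te≡) with DecL.incoming-U x w (λ inp → non-boundary x ∉i₁ (inj₂ (inj₁ inp)))
        ... | l , uL , tl≡ = l , StrG.wireIn (fV m x) (preserve m Wireᵗ x w) (fE m l) e (preserve-UEdge m l uL) uE
                                   (trans (sym (ft m l)) (cong (fV m) tl≡)) te≡
        at-kind (inj₁ w) (inj₁ se≡) with DecL.outgoing-U x w (λ out → non-boundary x ∉i₁ (inj₂ (inj₂ out)))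
        ... | l , uL , sl≡ = l , StrG.wireOut (fV m x) (preserve m Wireᵗ x w) (fE m l) e (preserve-UEdge m l uL) uE
                                   (trans (sym (fs m l)) (cong (fV m) sl≡)) se≡

    open Complement i₁ m mono finI finL finG

    endpoint-image : ∀ {x} ζ → Incident L x (fE i₁ ζ) → ImageV₁ x
    endpoint-image ζ (inj₁ s≡) = s I ζ , trans (fs i₁ ζ) s≡
    endpoint-image ζ (inj₂ t≡) = t I ζ , trans (ft i₁ ζ) t≡

    kept-edges-closed : ∀ e → ¬ DeletedE e → ¬ DeletedV (s G e) × ¬ DeletedV (t G e)
    kept-edges-closed e kept = deleted-end (inj₁ refl) , deleted-end (inj₂ refl)
      where
        deleted-end : ∀ {v} → Incident G v e → ¬ DeletedV v
        deleted-end inc (x , refl , ∉i₁) with dangling x ∉i₁ e inc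
        ... | l , refl = kept (l , refl , λ { (ζ , refl) → ∉i₁ (endpoint-image ζ (incident-reflect m mono l inc)) })

    open Construction kept-edges-closed public renaming (pushout to pushout₁)

    kept-interface : ∀ x → ¬ DeletedV (fV m x) → ImageV₁ x
    kept-interface x kept with DecL.imageV? finI i₁ x
    ... | yes img = img
    ... | no ∉i₁ = ⊥-elim (kept (x , refl , ∉i₁))

    kept-boundary : ∀ x → ¬ DeletedV (fV m x) → BoundV L x
    kept-boundary x kept with kept-interface x kept
    ... | z , refl = LegL.i-boundary z

    kept-not-node : ∀ x → ¬ DeletedV (fV m x) → ¬ IsNode L x
    kept-not-node x kept nd with kept-interface x kept
    ... | z , refl = LegL.i-no-node z (reflect i₁ Nodeᵗ z nd)

    endpoint : ∀ {v} l → Incident G v (fE m l) → Σ (V L) λ x → fV m x ≡ v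
    endpoint l (inj₁ s≡) = s L l , trans (fs m l) s≡
    endpoint l (inj₂ t≡) = t L l , trans (ft m l) t≡

    -- edges from a !-vertex to a kept vertex are kept: in L they are !-edges
    -- into the boundary, hence lie in the interface
    kept-bang-edge : ∀ e → IsBang G (s G e) → ¬ DeletedV (t G e) → ¬ DeletedE e
    kept-bang-edge e bs kept (l , refl , ∉i₁) =
      ∉i₁ (LegL.bang-edge-image l (reflect m (_≡ bang) (s L l) (subst (IsBang G) (sym (fs m l)) bs))
                                  (kept-boundary (t L l) (subst (¬_ ∘ DeletedV) (sym (ft m l)) kept)))

    -- edges at a kept node-vertex are kept: the interface has no node-vertices
    kept-node-edge : ∀ v e → ¬ DeletedV v → IsNode G v → Incident G v e → ¬ DeletedE e
    kept-node-edge v e kept nd inc (l , refl , _) with endpoint l inc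
    ... | x , refl = kept-not-node x kept (reflect m Nodeᵗ x nd)

    g-reflBox : ReflectsBoxContainment g
    g-reflBox e' (v ∣ [ kept ]) bs t≡ = (e' ∣ [ kept-bang-edge e' bs (subst (¬_ ∘ DeletedV) (sym t≡) kept) ]) , refl

    g-node-full : ∀ v → IsNode D v → ∀ e' → Incident G (fV g v) e' → Fixed G e' → Σ (E D) λ e → fE g e ≡ e'
    g-node-full (v ∣ [ kept ]) nd e' inc _ = (e' ∣ [ kept-node-edge v e' kept nd inc ]) , refl

    D-bang-graph : IsBangGraph D
    D-bang-graph = Embedding.bang-graph g (subIncl-mono G _ _ kept-edges-closed) g-reflBox g-node-full bgG D-finite

    d-mono : IsMono d
    d-mono = (λ z z' d≡ → proj₁ LegL.i-mono _ _ (proj₁ mono _ _ (cong value d≡))) ,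
             (λ z z' d≡ → proj₂ LegL.i-mono _ _ (proj₂ mono _ _ (cong value d≡)))

    open Glue d i₂ LegR.i-mono (DecR.imageV? finI i₂) (DecR.imageE? finI i₂) public renaming (pushout to pushout₂)

    private
      module BD = IsBangGraph D-bang-graph
      module BR = IsBangGraph bgR
      module StrD = StringConditions (stringConditions D BD.stringU)
      module StrR = StringConditions (stringConditions R BR.stringU)

    r-injV : ∀ y y' → rV y ≡ rV y' → y ≡ y'
    r-injV = proj₁ (r-mono d-mono)

    -- the new part of H contains no !-vertices: those all lie in the interface
    new-not-bang : ∀ {A : Set} (y : NewV) → IsBang H (inj₂ y) → A
    new-not-bang (y ∣ [ ∉i₂ ]) b = ⊥-elim-irr (∉i₂ (LegR.boundary-image y (inj₁ b)))

    old-not-node : ∀ y v → rV y ≡ inj₁ v → ¬ IsNode D v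
    old-not-node y v r≡ nd with rV-old y v r≡
    ... | z , _ , refl = LegR.i-no-node z (reflect d Nodeᵗ z nd)

    -- transport along h and r (graphs given explicitly to keep elaboration cheap)
    h-edge : ∀ {a c} → EdgeBetween D a c → EdgeBetween H (inj₁ a) (inj₁ c)
    h-edge = edge-map {D} {H} h

    r-nonbang : ∀ y → NonBang H (rV y) → NonBang R y
    r-nonbang = reflect {R} {H} r (_≢ bang)

    r-wire : ∀ y → IsWire H (rV y) → IsWire R y
    r-wire = reflect {R} {H} r Wireᵗ

    r-bang : ∀ y → IsBang H (rV y) → IsBang R y
    r-bang = reflect {R} {H} r (_≡ bang)

    h-node-full : ∀ v → IsNode D v → ∀ e' → Incident H (inj₁ v) e' → Σ (E D) λ e → inj₁ e ≡ e'
    h-node-full v nd (inj₁ e) _ = e , refl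
    h-node-full v nd (inj₂ a) (inj₁ s≡) = ⊥-elim (old-not-node _ v s≡ nd)
    h-node-full v nd (inj₂ a) (inj₂ t≡) = ⊥-elim (old-not-node _ v t≡ nd)

    r-node-full : ∀ y → IsNode R y → ∀ e' → Incident H (rV y) e' → Σ (E R) λ e → rE e ≡ e'
    r-node-full y nd (inj₁ e) (inj₁ s≡) = ⊥-elim (old-not-node y _ (sym s≡) (subst (IsNode H) (sym s≡) (preserve r Nodeᵗ y nd)))
    r-node-full y nd (inj₁ e) (inj₂ t≡) = ⊥-elim (old-not-node y _ (sym t≡) (subst (IsNode H) (sym t≡) (preserve r Nodeᵗ y nd)))
    r-node-full y nd (inj₂ (a ∣ [ ∉i₂ ])) _ = a , rE-new a ∉i₂

    H-nodeBij : ∀ v → IsNode H v → NodeBij H v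
    H-nodeBij (inj₁ v) nd = NodeBijTransfer.nodeBij-up {D} {H} h h-mono v (λ e' inc _ → h-node-full v nd e' inc) (StrD.nodeBij v nd)
    H-nodeBij (inj₂ (y ∣ [ ∉i₂ ])) nd = subst (NodeBij H) (rV-new y ∉i₂)
      (NodeBijTransfer.nodeBij-up {R} {H} r (r-mono d-mono) y (λ e' inc _ → r-node-full y nd e' inc) (StrR.nodeBij y nd))

    -- U-edges of L lie outside the interface, so their images in G are deleted
    U-edge-deleted : ∀ l → UEdge L l → DeletedE (fE m l)
    U-edge-deleted l (ns , _) = l , refl , λ { (ζ , refl) → ns (LegL.i-bang-edge ζ) }

    -- A U-edge a of D and a new U-edge b of R never meet at a wire of H.
    -- They could only meet at an interface vertex z.  If z is an input of R
    -- it has no incoming edge b; if it is an output of R it is an output of L,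
    -- whose (non-isolated) wire has an incoming U-edge l, and then a = m(l) in G
    -- would be deleted.
    no-mixed-in : ∀ (a : E D) (b : E R) → UEdge D a → UEdge R b → IsWire D (t D a) →
                  inj₁ (t D a) ≡ rV (t R b) → ⊥
    no-mixed-in (a ∣ [ kept ]) b uD uR w t≡ with rV-old (t R b) _ (sym t≡)
    ... | z , i₂z≡ , dz≡ with LegR.i-boundary z
    ...   | inj₁ bang-z = wire≢bang (subst (IsWire D) (sym dz≡) w) (preserve d (_≡ bang) z (reflect i₂ (_≡ bang) z bang-z))
    ...   | inj₂ (inj₁ inp) = proj₂ inp b (proj₁ uR) (proj₂ uR) (sym i₂z≡)
    ...   | inj₂ (inj₂ out) with output-in-L z out
    ...     | outL with noIsoL (fV i₁ z) (proj₁ outL)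
    ...       | l , uL , inj₁ s≡ = proj₂ outL l (proj₁ uL) (proj₂ uL) s≡
    ...       | l , uL , inj₂ t≡ = ⊥-elim-irr (kept (subst DeletedE (sym a≡ml) (U-edge-deleted l uL)))
      where
        a≡ml : a ≡ fE m l
        a≡ml = StrG.wireIn (t G a) w a (fE m l) uD (preserve-UEdge m l uL) refl
                 (trans (sym (ft m l)) (trans (cong (fV m) t≡) (cong value dz≡)))

    no-mixed-out : ∀ (a : E D) (b : E R) → UEdge D a → UEdge R b → IsWire D (s D a) →
                   inj₁ (s D a) ≡ rV (s R b) → ⊥
    no-mixed-out (a ∣ [ kept ]) b uD uR w s≡ with rV-old (s R b) _ (sym s≡)
    ... | z , i₂z≡ , dz≡ with LegR.i-boundary z
    ...   | inj₁ bang-z = wire≢bang (subst (IsWire D) (sym dz≡) w) (preserve d (_≡ bang) z (reflect i₂ (_≡ bang) z bang-z))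
    ...   | inj₂ (inj₂ out) = proj₂ out b (proj₁ uR) (proj₂ uR) (sym i₂z≡)
    ...   | inj₂ (inj₁ inp) with input-in-L z inp
    ...     | inL with noIsoL (fV i₁ z) (proj₁ inL)
    ...       | l , uL , inj₂ t≡ = proj₂ inL l (proj₁ uL) (proj₂ uL) t≡
    ...       | l , uL , inj₁ s≡ = ⊥-elim-irr (kept (subst DeletedE (sym a≡ml) (U-edge-deleted l uL)))
      where
        a≡ml : a ≡ fE m l
        a≡ml = StrG.wireOut (s G a) w a (fE m l) uD (preserve-UEdge m l uL) refl
                 (trans (sym (fs m l)) (trans (cong (fV m) s≡) (cong value dz≡)))

    new-UEdge : ∀ a → UEdge H (inj₂ a) → UEdge R (value a)
    new-UEdge a (ns , nt) = r-nonbang (s R (value a)) ns , r-nonbang (t R (value a)) nt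

    -- two U-edges at a wire of H come both from D or both from R, where the
    -- string conditions hold
    H-wireIn : ∀ v → IsWire H v → ∀ e e' → UEdge H e → UEdge H e' → t H e ≡ v → t H e' ≡ v → e ≡ e'
    H-wireIn _ w (inj₁ a) (inj₁ b) u u' refl t≡ = cong inj₁ (StrD.wireIn (t D a) w a b u u' refl (inj₁-injective t≡))
    H-wireIn _ w (inj₂ a) (inj₂ b) u u' refl t≡ = cong inj₂ (value-injective
      (StrR.wireIn _ (r-wire _ w) _ _ (new-UEdge a u) (new-UEdge b u') refl (r-injV _ _ t≡)))
    H-wireIn _ w (inj₁ a) (inj₂ b) u u' refl t≡ = ⊥-elim (no-mixed-in a (value b) u (new-UEdge b u') w (sym t≡))
    H-wireIn _ w (inj₂ a) (inj₁ b) u u' refl t≡ =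
      ⊥-elim (no-mixed-in b (value a) u' (new-UEdge a u) (subst (IsWire H) (sym t≡) w) t≡)

    H-wireOut : ∀ v → IsWire H v → ∀ e e' → UEdge H e → UEdge H e' → s H e ≡ v → s H e' ≡ v → e ≡ e'
    H-wireOut _ w (inj₁ a) (inj₁ b) u u' refl s≡ = cong inj₁ (StrD.wireOut (s D a) w a b u u' refl (inj₁-injective s≡))
    H-wireOut _ w (inj₂ a) (inj₂ b) u u' refl s≡ = cong inj₂ (value-injective
      (StrR.wireOut _ (r-wire _ w) _ _ (new-UEdge a u) (new-UEdge b u') refl (r-injV _ _ s≡)))
    H-wireOut _ w (inj₁ a) (inj₂ b) u u' refl s≡ = ⊥-elim (no-mixed-out a (value b) u (new-UEdge b u') w (sym s≡))
    H-wireOut _ w (inj₂ a) (inj₁ b) u u' refl s≡ =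
      ⊥-elim (no-mixed-out b (value a) u' (new-UEdge a u) (subst (IsWire H) (sym s≡) w) s≡)

    H-string : StringConditions H
    H-string = record { nodeBij = H-nodeBij ; wireIn = H-wireIn ; wireOut = H-wireOut }

    interface-bang : ∀ z → IsBang D (fV d z) → IsBang R (fV i₂ z)
    interface-bang z b = preserve i₂ (_≡ bang) z (reflect d (_≡ bang) z b)

    -- an edge of D from a !-vertex into the interface comes from I, since in G it
    -- comes from a !-edge of L into the boundary (reflection of box containment)
    interface-bang-edge : ∀ e z → IsBang D (s D e) → t D e ≡ fV d z → Σ (E I) λ ζ → fE d ζ ≡ e
    interface-bang-edge e z bs t≡ with reflBox (value e) (fV i₁ z) bs (cong value t≡)
    ... | l , ml≡ with LegL.bang-edge-image l
                         (reflect m (_≡ bang) (s L l) (subst (IsBang G) (sym (trans (fs m l) (cong (s G) ml≡))) bs))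
                         (subst (BoundV L) (proj₁ mono _ _ (trans (cong value (sym t≡)) (sym (trans (ft m l) (cong (t G) ml≡)))))
                                (LegL.i-boundary z))
    ... | ζ , refl = ζ , value-injective ml≡

    -- the box of an old !-vertex b of H: on D it is the box of b in D, and on the
    -- image of r it is the box in R of the corresponding interface vertex
    box-in-D : ∀ b v → IsBang D b → InBox H (inj₁ b) (inj₁ v) → InBox D b v
    box-in-D b v bb (inj₁ e , s≡ , t≡) = e , inj₁-injective s≡ , inj₁-injective t≡
    box-in-D b v bb (inj₂ (a ∣ [ ∉i₂ ]) , s≡ , t≡) with rV-old (t R a) v t≡
    ... | z , i₂z≡ , _ = ⊥-elim-irr (∉i₂ (LegR.bang-edge-image a
                           (r-bang (s R a) (subst (IsBang H) (sym s≡) bb))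
                           (subst (BoundV R) i₂z≡ (LegR.i-boundary z))))

    -- an R-vertex y lies in the box of b in H exactly via an interface vertex
    InBoxR : V D → V R → Set
    InBoxR b y = Σ (V I) λ z → (fV d z ≡ b) × InBox R (fV i₂ z) y

    interface-box : ∀ b z' → IsBang D b → InBox D b (fV d z') → InBoxR b (fV i₂ z')
    interface-box b z' bb (e , s≡ , t≡) with interface-bang-edge e z' (subst (IsBang D) (sym s≡) bb) t≡
    ... | ζ , refl = s I ζ , trans (fs d ζ) s≡ , edge-map {I} {R} i₂ (ζ , refl , proj₁ d-mono _ _ (trans (ft d ζ) t≡))

    box-into-R : ∀ b y → IsBang D b → InBox H (inj₁ b) (rV y) → InBoxR b y
    box-into-R b y bb (inj₁ e , s≡ , t≡) = via (rV-old y (t D e) (sym t≡))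
      where
        via : Σ (V I) (λ z → (fV i₂ z ≡ y) × (fV d z ≡ t D e)) → InBoxR b y
        via (z' , refl , dz'≡) = interface-box b z' bb (e , inj₁-injective s≡ , sym dz'≡)
    box-into-R b y bb (inj₂ a , s≡ , t≡) = via (rV-old (s R (value a)) b s≡)
      where
        via : Σ (V I) (λ z → (fV i₂ z ≡ s R (value a)) × (fV d z ≡ b)) → InBoxR b y
        via (z , i₂z≡ , dz≡) = z , dz≡ , (value a , sym i₂z≡ , r-injV _ _ t≡)

    box-from-R : ∀ b z y → fV d z ≡ b → InBox R (fV i₂ z) y → InBox H (inj₁ b) (rV y)
    box-from-R _ z y refl inR = subst (λ u → EdgeBetween H u (rV y)) (rV-image z) (edge-map {R} {H} r inR)

    module BoxD (b : V D) (bb : IsBang D b) = BoxConditions (boxConditions D b (BD.boxOpen b bb))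
    module BoxR (z : V I) (bz : IsBang D (fV d z)) =
      BoxConditions (boxConditions R (fV i₂ z) (BR.boxOpen (fV i₂ z) (interface-bang z bz)))

    -- the box of b in H is open: edges from D are handled in D, edges from R in R
    H-box : ∀ b → IsBang D b → BoxConditions H (inj₁ b)
    H-box b bb = record { fixedClosed = closed ; noWireExit = no-exit }
      where
        module Bb = BoxD b bb

        closed-D : ∀ v e → InBox D b v → Incident D v e → Fixed D e →
                   InBox H (inj₁ b) (inj₁ (s D e)) × InBox H (inj₁ b) (inj₁ (t D e))
        closed-D v e inb inc fx = map-× h-edge h-edge (Bb.fixedClosed v e inb inc fx)

        closed-R : ∀ y e → Incident R y e → Fixed R e → InBoxR b y →
                   InBox H (inj₁ b) (rV (s R e)) × InBox H (inj₁ b) (rV (t R e))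
        closed-R y e inc fx (z , dz≡ , inR) =
          map-× (box-from-R b z (s R e) dz≡) (box-from-R b z (t R e) dz≡)
                (BoxR.fixedClosed z (subst (IsBang D) (sym dz≡) bb) y e inR inc fx)

        closed : ∀ v e → InBox H (inj₁ b) v → Incident H v e → Fixed H e →
                 InBox H (inj₁ b) (s H e) × InBox H (inj₁ b) (t H e)
        closed _ (inj₁ e) inb (inj₁ refl) fx = closed-D (s D e) e (box-in-D b (s D e) bb inb) (inj₁ refl) fx
        closed _ (inj₁ e) inb (inj₂ refl) fx = closed-D (t D e) e (box-in-D b (t D e) bb inb) (inj₂ refl) fx
        closed _ (inj₂ a) inb (inj₁ refl) fx = closed-R (s R (value a)) (value a) (inj₁ refl) fx (box-into-R b _ bb inb)
        closed _ (inj₂ a) inb (inj₂ refl) fx = closed-R (t R (value a)) (value a) (inj₂ refl) fx (box-into-R b _ bb inb)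

        no-exit-D : ∀ v w e → InBox D b v → NonBang D v → ¬ InBox H (inj₁ b) (inj₁ w) → IsWire D w →
                    UEdge D e → ¬ Joins D e v w
        no-exit-D v w e inb nb ∉inb = Bb.noWireExit v w e inb nb (∉inb ∘ h-edge)

        no-exit-R : ∀ y y' a → InBoxR b y → NonBang R y → ¬ InBox H (inj₁ b) (rV y') → IsWire R y' →
                    UEdge R a → ¬ Joins R a y y'
        no-exit-R y y' a (z , dz≡ , inR) nb ∉inb =
          BoxR.noWireExit z (subst (IsBang D) (sym dz≡) bb) y y' a inR nb (∉inb ∘ box-from-R b z y' dz≡)

        no-exit : ∀ v w e → InBox H (inj₁ b) v → NonBang H v → ¬ InBox H (inj₁ b) w → IsWire H w →
                  UEdge H e → ¬ Joins H e v w
        no-exit _ _ (inj₁ e) inb nb ∉inb ww u (inj₁ (refl , refl)) =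
          no-exit-D (s D e) (t D e) e (box-in-D b (s D e) bb inb) nb ∉inb ww u (inj₁ (refl , refl))
        no-exit _ _ (inj₁ e) inb nb ∉inb ww u (inj₂ (refl , refl)) =
          no-exit-D (t D e) (s D e) e (box-in-D b (t D e) bb inb) nb ∉inb ww u (inj₂ (refl , refl))
        no-exit _ _ (inj₂ a) inb nb ∉inb ww u (inj₁ (refl , refl)) =
          no-exit-R (s R (value a)) (t R (value a)) (value a) (box-into-R b _ bb inb) (r-nonbang _ nb) ∉inb
                    (r-wire _ ww) (new-UEdge a u) (inj₁ (refl , refl))
        no-exit _ _ (inj₂ a) inb nb ∉inb ww u (inj₂ (refl , refl)) =
          no-exit-R (t R (value a)) (s R (value a)) (value a) (box-into-R b _ bb inb) (r-nonbang _ nb) ∉inb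
                    (r-wire _ ww) (new-UEdge a u) (inj₂ (refl , refl))

    -- a new edge between !-vertices would be a !-edge into the boundary of R,
    -- hence in the interface
    new-edge-not-bang : ∀ (a : NewE) → IsBang H (s H (inj₂ a)) → IsBang H (t H (inj₂ a)) → ⊥
    new-edge-not-bang (a ∣ [ ∉i₂ ]) bs bt =
      ⊥-elim-irr (∉i₂ (LegR.bang-edge-image a (r-bang (s R a) bs) (inj₁ (r-bang (t R a) bt))))

    -- all !-vertices of H and the edges between them lie in D, so the conditions
    -- on β(H) are those on β(D)
    H-βsimple : ∀ e e' → IsBang H (s H e) → IsBang H (t H e) → s H e ≡ s H e' → t H e ≡ t H e' → e ≡ e'
    H-βsimple (inj₁ a) (inj₁ a') bs bt s≡ t≡ = cong inj₁ (BD.βsimple a a' bs bt (inj₁-injective s≡) (inj₁-injective t≡))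
    H-βsimple (inj₁ a) (inj₂ a') bs bt s≡ t≡ = ⊥-elim (new-edge-not-bang a' (subst (IsBang H) s≡ bs) (subst (IsBang H) t≡ bt))
    H-βsimple (inj₂ a) _ bs bt _ _ = ⊥-elim (new-edge-not-bang a bs bt)

    H-βrefl : ∀ b → IsBang H b → EdgeBetween H b b
    H-βrefl (inj₁ b) bb = h-edge (BD.βrefl b bb)
    H-βrefl (inj₂ y) bb = new-not-bang y bb

    H-βtrans : ∀ a b c → IsBang H a → IsBang H b → IsBang H c →
               EdgeBetween H a b → EdgeBetween H b c → EdgeBetween H a c
    H-βtrans (inj₁ a) (inj₁ b) (inj₁ c) ba bb bc ab bc' =
      h-edge (BD.βtrans a b c ba bb bc (box-in-D a b ba ab) (box-in-D b c bb bc'))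
    H-βtrans (inj₂ y) _ _ ba _ _ _ _ = new-not-bang y ba
    H-βtrans (inj₁ _) (inj₂ y) _ _ bb _ _ _ = new-not-bang y bb
    H-βtrans (inj₁ _) (inj₁ _) (inj₂ y) _ _ bc _ _ = new-not-bang y bc

    H-βantisym : ∀ a b → IsBang H a → IsBang H b → EdgeBetween H a b → EdgeBetween H b a → a ≡ b
    H-βantisym (inj₁ a) (inj₁ b) ba bb ab ba' = cong inj₁ (BD.βantisym a b ba bb (box-in-D a b ba ab) (box-in-D b a bb ba'))
    H-βantisym (inj₂ y) _ ba _ _ _ = new-not-bang y ba
    H-βantisym (inj₁ _) (inj₂ y) _ bb _ _ = new-not-bang y bb

    -- nesting of boxes: a vertex of R in the box of b' ∈ B(b) is, in R, in the
    -- box of the interface vertex of b' and hence of b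
    nest-R : ∀ b b' y → IsBang D b → IsBang D b' → InBox D b b' → InBoxR b' y → InBox H (inj₁ b) (rV y)
    nest-R b _ y bb bb' inb (z' , refl , inR') = via (interface-box b z' bb inb)
      where
        via : InBoxR b (fV i₂ z') → InBox H (inj₁ b) (rV y)
        via (z , dz≡ , inR) = box-from-R b z y dz≡
          (BR.boxNest _ _ (interface-bang z (subst (IsBang D) (sym dz≡) bb)) (interface-bang z' bb') inR y inR')

    H-boxNest : ∀ b b' → IsBang H b → IsBang H b' → InBox H b b' → ∀ v → InBox H b' v → InBox H b v
    H-boxNest (inj₁ b) (inj₁ b') bb bb' inb (inj₁ v) inb' =
      h-edge (BD.boxNest b b' bb bb' (box-in-D b b' bb inb) v (box-in-D b' v bb' inb'))
    H-boxNest (inj₁ b) (inj₁ b') bb bb' inb (inj₂ (y ∣ [ ∉i₂ ])) inb' =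
      subst (InBox H (inj₁ b)) (rV-new y ∉i₂)
            (nest-R b b' y bb bb' (box-in-D b b' bb inb) (box-into-R b' y bb' (subst (InBox H (inj₁ b')) (sym (rV-new y ∉i₂)) inb')))
    H-boxNest (inj₂ y) _ bb _ _ _ _ = new-not-bang y bb
    H-boxNest (inj₁ _) (inj₂ y) _ bb' _ _ _ = new-not-bang y bb'

    H-bang-graph : IsBangGraph H
    H-bang-graph = record
      { finite   = H-finite D-finite finR
      ; stringU  = U-string H H-string
      ; βsimple  = H-βsimple
      ; βrefl    = H-βrefl
      ; βtrans   = H-βtrans
      ; βantisym = H-βantisym
      ; boxOpen  = λ { (inj₁ b) bb → box-open H (inj₁ b) (U-string H H-string) (H-box b bb)
                     ; (inj₂ y) bb → new-not-bang y bb }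
      ; boxNest  = H-boxNest
      }

theorem5p12 : (T : Sig) → let open Over T in
    ∀ {L I R G : TGraph} (i₁ : Hom I L) (i₂ : Hom I R) → IsRewriteRule i₁ i₂ →
    (m : Hom L G) → IsMatching m →
    Σ TGraph λ D → Σ TGraph λ H →
    Σ (Hom I D) λ d → Σ (Hom D G) λ g → Σ (Hom R H) λ r → Σ (Hom D H) λ h →
      IsBangGraph D × IsBangGraph H ×
      (g ∘H d ≈H m ∘H i₁) × (h ∘H d ≈H r ∘H i₂) ×
      IsPushout i₁ d m g × IsPushout d i₂ h r
theorem5p12 T i₁ i₂ rule m matching =
  D , H , d , g , r , h , D-bang-graph , H-bang-graph , g∘d , h∘d , pushout₁ , pushout₂
  where open Rewriting.Rewrite T i₁ i₂ rule m matching
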